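{- Let $M_n$ be the Motzkin numbers and $T_n=ct\left[(x^{ -1}+1+x)^n\right]$ the central trinomial coefficients, and let $p$ be a prime. Then $(M_n\bmod p)_{n\ge 0}$ is uniformly recurrent if and only if $p$ divides no $T_n$ ($n\ge0$). Furthermore, if $p$ divides some $T_n$, then the set $\{n\ge 0: M_n\equiv 0\pmod p\}$ has density $1$.
   Context: $ct[R(x)]$ denotes the constant term of a Laurent polynomial $R(x)$. The Motzkin number $M_n$ is the number of lattice paths from $(0,0)$ to $(n,0)$ with steps $(1,1),(1,0),(1,-1)$ never going below the $x$-axis; equivalently $M_n=ct\left[(x^{ -1}+1+x)^n(1-x^2)\right]$. A sequence $(s_n)$ is uniformly recurrent if for every finite word $w=s_i\cdots s_{i+\ell-1}$ occurring in it there is a constant $C_w$ such that every occurrence of $w$ is followed by another occurrence of $w$ starting at distance at most $C_w$. A set $S\subseteq\mathbb{Z}_{\ge0}$ has density $1$ if $|S\cap\{0,\ldots,N-1\}|/N\to1$. -}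

module Defs where

open import Data.Nat using (ℕ; zero; suc; _+_; _*_; _∸_; _<_; _≤_; _≥_; _%_; NonZero)
open import Data.Nat.Primality using (Prime; prime⇒nonZero)
open import Data.Integer as ℤ using (ℤ)
open import Data.Bool using (Bool; true; false)
open import Data.Product using (∃-syntax; _×_)
open import Relation.Binary.PropositionalEquality using (_≡_)
open import Relation.Nullary using (Dec; yes; no)
open import Relation.Unary using (Pred; Decidable)
open import Level using (0ℓ)

-- Motzkin numbers via lattice paths:
-- paths n h = number of paths with n steps (1,1),(1,0),(1,-1) starting at
-- height h, ending at height 0, never going below height 0.
paths : ℕ → ℕ → ℕ
paths zero    zero    = 1
paths zero    (suc h) = 0
paths (suc n) zero    = paths n 1 + paths n 0
paths (suc n) (suc h) = paths n (suc (suc h)) + paths n (suc h) + paths n h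

Motzkin : ℕ → ℕ
Motzkin n = paths n 0

-- coeff n k = coefficient of x^k in the Laurent polynomial (x⁻¹ + 1 + x)^n
coeff : ℕ → ℤ → ℕ
coeff zero k with k ℤ.≟ ℤ.0ℤ
... | yes _ = 1
... | no  _ = 0
coeff (suc n) k = coeff n (k ℤ.- ℤ.1ℤ) + coeff n k + coeff n (k ℤ.+ ℤ.1ℤ)

T : ℕ → ℕ
T n = coeff n ℤ.0ℤ

_mod′_ : ℕ → (p : ℕ) → {Prime p} → ℕ
(x mod′ p) {pp} = let instance _ = prime⇒nonZero pp in x % p

OccursAt : (ℕ → ℕ) → (i ℓ j : ℕ) → Set
OccursAt s i ℓ j = ∀ t → t < ℓ → s (j + t) ≡ s (i + t)

UniformlyRecurrent : (ℕ → ℕ) → Set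
UniformlyRecurrent s =
  ∀ i ℓ → ∃[ C ] (∀ j → OccursAt s i ℓ j →
                   ∃[ k ] (j < k × k ≤ j + C × OccursAt s i ℓ k))

countBelow : {P : Pred ℕ 0ℓ} → Decidable P → ℕ → ℕ
countBelow P? zero = 0
countBelow P? (suc N) with P? N
... | yes _ = suc (countBelow P? N)
... | no  _ = countBelow P? N

-- density 1: |S ∩ [0,N)|/N → 1, i.e. for every k ≥ 1 eventually
-- the proportion (N - |S ∩ [0,N)|)/N of non-members is at most 1/k
HasDensityOne : {P : Pred ℕ 0ℓ} → Decidable P → Set
HasDensityOne P? =
  ∀ k → k ≥ 1 → ∃[ N₀ ] (∀ N → N ≥ N₀ → k * (N ∸ countBelow P? N) ≤ N)

{-# OPTIONS --safe #-}
module Submission where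

-- Frobenius for the commuting shift operators gives (x⁻¹ + 1 + x)ᵖ ≡ x⁻ᵖ + 1 + xᵖ (mod p), hence a
-- Lucas-type congruence: for a digit r < p the residues of T and of T₁ n = [x¹](x⁻¹ + 1 + x)ⁿ at
-- r + X p are linear in their residues at X, and so is M (r + X p), since M n = T n − [x²](x⁻¹ + 1 + x)ⁿ
-- by the reflection principle.  So M n mod p is computed by an automaton reading the base-p digits
-- of n, with state (T, T₁) mod p.
--
-- If p divides some T n, it divides T d for one of its digits d.  The state then vanishes as soon as
-- the base-p² digits of n / p contain d p; almost all n are of this kind, so M n ≡ 0 (mod p) on a set
-- of density 1, and uniform recurrence fails because M 0 = 1.
--
-- If p divides no T n, Fermat's little theorem inverts every T X by some T s with s of bounded
-- length, so the numbers Y p with state (1, 0), the state of 0, occur in every interval of bounded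
-- length.  Writing such a number above the digits of a factor of the sequence reproduces the factor.

open import Defs

open import Algebra.Bundles using (Semiring)
open import Data.Fin.Base using (Fin; zero; suc; toℕ; fromℕ; inject₁)
open import Data.Fin.Properties using (toℕ-fromℕ; toℕ-inject₁; toℕ<n)
open import Data.Nat.Base as ℕ using (ℕ; zero; suc; _<_; _∸_; _!; s≤s; z≤n; nonTrivial⇒≢1)
open import Data.Nat.Combinatorics using (_C_; nCk≡n!/k![n-k]!; k![n∸k]!∣n!; nCn≡1)
open import Data.Nat.DivMod using (m/n*n≡m)
open import Data.Nat.Divisibility using (_∣_; quotient; ∣⇒≤; ∣1⇒≡1; m∣m*n; n∣m*n)
open import Data.Nat.Primality
  using (Prime; euclidsLemma; prime⇒nonTrivial; prime⇒nonZero; ¬prime[0]; ¬prime[1])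
open import Data.Nat.Properties using (<⇒≱; <⇒≤; ∸-monoʳ-<; n∸n≡0; _!*_!≢0)
import Data.Nat.Properties as ℕₚ
open import Data.Product using (∃-syntax; _,_)
open import Data.Sum using (inj₁; inj₂)
open import Function.Bundles using (_⇔_; mk⇔)
open import Relation.Binary.PropositionalEquality
  using (_≡_; _≢_; _≗_; refl; sym; trans; cong; cong₂; subst; subst₂; module ≡-Reasoning)
open import Relation.Nullary using (¬_; Dec; does; yes; no; contradiction)

-- Frobenius in a semiring

p∤n! : ∀ {p n} → Prime p → n < p → ¬ p ∣ n !
p∤n! {p} {zero}  pp _   p∣1        = nonTrivial⇒≢1 {{prime⇒nonTrivial pp}} (∣1⇒≡1 p∣1)
p∤n! {p} {suc n} pp n<p p∣[1+n]! with euclidsLemma (suc n) (n !) pp p∣[1+n]!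
... | inj₁ p∣1+n = <⇒≱ n<p (∣⇒≤ p∣1+n)
... | inj₂ p∣n!  = p∤n! pp (<⇒≤ n<p) p∣n!

p∣pCk : ∀ {p k} → Prime p → 0 < k → k < p → p ∣ p C k
p∣pCk {p@(suc p-1)} {k} pp 0<k k<p
  with euclidsLemma (p C k) (k ! ℕ.* (p ∸ k) !) pp (subst (p ∣_) (sym pCk*k![p∸k]!≡p!) (m∣m*n (p-1 !)))
  where
    pCk*k![p∸k]!≡p! : (p C k) ℕ.* (k ! ℕ.* (p ∸ k) !) ≡ p !
    pCk*k![p∸k]!≡p! = trans (cong (ℕ._* (k ! ℕ.* (p ∸ k) !)) (nCk≡n!/k![n-k]! (<⇒≤ k<p)))
                            (m/n*n≡m {{k !* (p ∸ k) !≢0}} (k![n∸k]!∣n! (<⇒≤ k<p)))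
... | inj₁ p∣pCk = p∣pCk
... | inj₂ p∣k![p∸k]! with euclidsLemma (k !) ((p ∸ k) !) pp p∣k![p∸k]!
...   | inj₁ p∣k!     = contradiction p∣k! (p∤n! pp k<p)
...   | inj₂ p∣[p∸k]! = contradiction p∣[p∸k]! (p∤n! pp (∸-monoʳ-< 0<k (<⇒≤ k<p)))

module Frobenius {c ℓ} (S : Semiring c ℓ) where

  open Semiring S hiding (zero; refl) renaming (sym to ≈-sym; trans to ≈-trans)
  open import Algebra.Definitions.RawSemiring rawSemiring using (_^_; _×_; sum)
  open import Algebra.Properties.CommutativeMonoid.Mult +-commutativeMonoid using (×-distrib-+)
  open import Algebra.Properties.CommutativeSemigroup +-commutativeSemigroup using (x∙yz≈zx∙y)
  open import Algebra.Properties.Monoid.Mult +-monoid using (×-assocˡ)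
  open import Algebra.Properties.Monoid.Sum +-monoid
    using (sum-cong-≋; sum-init-last; sum-replicate; sum-replicate-zero)
  open import Algebra.Properties.Semiring.Binomial S using (binomial; binomialTerm; theorem)
  open import Data.Vec.Functional using (Vector)
  open import Relation.Binary.Reasoning.Setoid setoid

  ×-distrib-sum : ∀ n {m} (u : Vector Carrier m) → sum (λ i → n × u i) ≈ n × sum u
  ×-distrib-sum n {zero}  u = ≈-sym (≈-trans (≈-sym (sum-replicate n)) (sum-replicate-zero n))
  ×-distrib-sum n {suc m} u = begin
    n × u zero + sum (λ i → n × u (suc i))  ≈⟨ +-congˡ (×-distrib-sum n (λ i → u (suc i))) ⟩
    n × u zero + n × sum (λ i → u (suc i))  ≈⟨ ×-distrib-+ _ _ n ⟨
    n × sum u                               ∎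

  frobenius : ∀ {p} → Prime p → ∀ x y → x * y ≈ y * x → ∃[ z ] ((x + y) ^ p ≈ x ^ p + y ^ p + p × z)
  frobenius {0} pp = contradiction pp ¬prime[0]
  frobenius {1} pp = contradiction pp ¬prime[1]
  frobenius {p@(suc (suc m))} pp x y xy≈yx = sum u , (begin
    (x + y) ^ p                                               ≈⟨ theorem x y xy≈yx p ⟩
    t zero + sum (λ i → t (suc i))                            ≈⟨ +-cong first (sum-init-last (λ i → t (suc i))) ⟩
    y ^ p + (sum (λ i → t (suc (inject₁ i))) + t (fromℕ p))   ≈⟨ +-congˡ (+-cong (sum-cong-≋ middle) last) ⟩
    y ^ p + (sum (λ i → p × u i) + x ^ p)                     ≈⟨ +-congˡ (+-congʳ (×-distrib-sum p u)) ⟩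
    y ^ p + (p × sum u + x ^ p)                               ≈⟨ x∙yz≈zx∙y _ _ _ ⟩
    x ^ p + y ^ p + p × sum u                                 ∎)
    where
      t = binomialTerm x y p
      first : t zero ≈ y ^ p
      first = ≈-trans (+-identityʳ _) (*-identityˡ _)
      last : t (fromℕ p) ≈ x ^ p
      last = begin
        t (fromℕ p)                      ≡⟨ cong (λ j → (p C j) × (x ^ j * y ^ (p ∸ j))) (toℕ-fromℕ p) ⟩
        (p C p) × (x ^ p * y ^ (p ∸ p))  ≡⟨ cong₂ (λ c e → c × (x ^ p * y ^ e)) (nCn≡1 p) (n∸n≡0 p) ⟩
        x ^ p * 1# + 0#                  ≈⟨ ≈-trans (+-identityʳ _) (*-identityʳ _) ⟩
        x ^ p                            ∎
      p∣middle : ∀ (i : Fin (suc m)) → p ∣ p C toℕ (suc (inject₁ i))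
      p∣middle i = p∣pCk pp (s≤s z≤n) (subst (λ j → suc j < p) (sym (toℕ-inject₁ i)) (s≤s (toℕ<n i)))
      u : Vector Carrier (suc m)
      u i = quotient (p∣middle i) × binomial x y p (suc (inject₁ i))
      middle : ∀ i → t (suc (inject₁ i)) ≈ p × u i
      middle i = begin
        t (suc (inject₁ i))                   ≡⟨ cong (_× b) (_∣_.equality (p∣middle i)) ⟩
        (quotient (p∣middle i) ℕ.* p) × b     ≡⟨ cong (_× b) (ℕₚ.*-comm (quotient (p∣middle i)) p) ⟩
        (p ℕ.* quotient (p∣middle i)) × b     ≈⟨ ×-assocˡ b p (quotient (p∣middle i)) ⟨
        p × u i                               ∎
        where b = binomial x y p (suc (inject₁ i))

open import Data.Bool.Base using (if_then_else_)
open import Data.Nat.Base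
open import Data.Nat.DivMod hiding (_mod_)
open import Data.Nat.Divisibility using (m%n≡0⇒n∣m; n∣m⇒m%n≡0; >⇒∤)
open import Data.Nat.Induction using (<-rec)
open import Data.Nat.Properties
open import Data.Nat.Tactic.RingSolver using (solve-∀)
open import Data.Product using (_×_; proj₁; proj₂)
open import Level using (0ℓ)
open import Relation.Binary.Bundles using (Setoid)
import Relation.Binary.Construct.On as On
import Relation.Binary.PropositionalEquality as ≡
import Relation.Binary.Reasoning.Setoid as SetoidReasoning
open import Relation.Unary using (Pred; Decidable)

-- Congruences and Fermat's little theorem

infix 4 _≡_mod_
_≡_mod_ : ℕ → ℕ → (m : ℕ) → .{{NonZero m}} → Set
_≡_mod_ x y m = x % m ≡ y % m

∣∧<⇒≡0 : ∀ {m n} → m ∣ n → n < m → n ≡ 0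
∣∧<⇒≡0 {n = zero}  _   _   = refl
∣∧<⇒≡0 {n = suc _} m∣n n<m = contradiction m∣n (>⇒∤ n<m)

module ModularArithmetic (m : ℕ) .{{_ : NonZero m}} where

  ≡-mod-setoid : Setoid 0ℓ 0ℓ
  ≡-mod-setoid = On.setoid (≡.setoid ℕ) (_% m)

  open Setoid ≡-mod-setoid public using () renaming (refl to ≡-mod-refl; trans to ≡-mod-trans)

  module ≡-mod-Reasoning = SetoidReasoning ≡-mod-setoid

  ≡⇒≡-mod : ∀ {x y} → x ≡ y → x ≡ y mod m
  ≡⇒≡-mod = cong (_% m)

  %-≡-mod : ∀ x → x % m ≡ x mod m
  %-≡-mod x = m%n%n≡m%n x m

  +-cong-mod : ∀ {a b c d} → a ≡ b mod m → c ≡ d mod m → a + c ≡ b + d mod m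
  +-cong-mod {a} {b} {c} {d} a≡b c≡d = begin
    (a + c) % m           ≡⟨ %-distribˡ-+ a c m ⟩
    (a % m + c % m) % m   ≡⟨ cong₂ (λ u v → (u + v) % m) a≡b c≡d ⟩
    (b % m + d % m) % m   ≡⟨ %-distribˡ-+ b d m ⟨
    (b + d) % m           ∎
    where open ≡-Reasoning

  *-cong-mod : ∀ {a b c d} → a ≡ b mod m → c ≡ d mod m → a * c ≡ b * d mod m
  *-cong-mod {a} {b} {c} {d} a≡b c≡d = begin
    (a * c) % m           ≡⟨ %-distribˡ-* a c m ⟩
    (a % m * (c % m)) % m ≡⟨ cong₂ (λ u v → (u * v) % m) a≡b c≡d ⟩
    (b % m * (d % m)) % m ≡⟨ %-distribˡ-* b d m ⟨
    (b * d) % m           ∎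
    where open ≡-Reasoning

  ^-cong-mod : ∀ {a b} n → a ≡ b mod m → a ^ n ≡ b ^ n mod m
  ^-cong-mod zero    a≡b = refl
  ^-cong-mod (suc n) a≡b = *-cong-mod a≡b (^-cong-mod n a≡b)

  0%m≡0 : 0 % m ≡ 0
  0%m≡0 = n∣m⇒m%n≡0 0 m (n∣m*n 0)

  ∣⇒≡0-mod : ∀ {x} → m ∣ x → x ≡ 0 mod m
  ∣⇒≡0-mod {x} m∣x = trans (n∣m⇒m%n≡0 x m m∣x) (sym 0%m≡0)

  ≡0-mod⇒∣ : ∀ {x} → x ≡ 0 mod m → m ∣ x
  ≡0-mod⇒∣ {x} x≡0 = m%n≡0⇒n∣m x m (trans x≡0 0%m≡0)

  m*x≡0-mod : ∀ x → m * x ≡ 0 mod m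
  m*x≡0-mod x = ∣⇒≡0-mod (m∣m*n x)

  -- w = m ∸ a % m is an additive inverse of a.
  +-cancelˡ-mod : ∀ a {b c} → a + b ≡ a + c mod m → b ≡ c mod m
  +-cancelˡ-mod a {b} {c} a+b≡a+c = begin
    b                  ≈⟨ +-cong-mod w+a≡0 ≡-mod-refl ⟨
    w + a + b          ≡⟨ +-assoc w a b ⟩
    w + (a + b)        ≈⟨ +-cong-mod (≡-mod-refl {w}) a+b≡a+c ⟩
    w + (a + c)        ≡⟨ +-assoc w a c ⟨
    w + a + c          ≈⟨ +-cong-mod w+a≡0 ≡-mod-refl ⟩
    c                  ∎
    where
      open ≡-mod-Reasoning
      w = m ∸ a % m
      w+a≡0 : w + a ≡ 0 mod m
      w+a≡0 = begin
        w + a          ≈⟨ +-cong-mod (≡-mod-refl {w}) (%-≡-mod a) ⟨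
        w + a % m      ≡⟨ m∸n+n≡m (<⇒≤ (m%n<n a m)) ⟩
        m              ≡⟨ *-identityʳ m ⟨
        m * 1          ≈⟨ m*x≡0-mod 1 ⟩
        0              ∎

module _ where

  open import Algebra.Definitions.RawSemiring (Semiring.rawSemiring +-*-semiring)
    using () renaming (_^_ to _^ˢ_; _×_ to _×ˢ_)

  private
    ^ˢ≡^ : ∀ a n → a ^ˢ n ≡ a ^ n
    ^ˢ≡^ a zero    = refl
    ^ˢ≡^ a (suc n) = cong (a *_) (^ˢ≡^ a n)

    ×ˢ≡* : ∀ n a → n ×ˢ a ≡ n * a
    ×ˢ≡* zero    a = refl
    ×ˢ≡* (suc n) a = cong (a +_) (×ˢ≡* n a)

  frobeniusℕ : ∀ {p} → Prime p → ∀ a b → ∃[ z ] ((a + b) ^ p ≡ a ^ p + b ^ p + p * z)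
  frobeniusℕ {p} pp a b with Frobenius.frobenius +-*-semiring pp a b (*-comm a b)
  ... | z , eq = z , (begin
    (a + b) ^ p                ≡⟨ ^ˢ≡^ (a + b) p ⟨
    (a + b) ^ˢ p               ≡⟨ eq ⟩
    a ^ˢ p + b ^ˢ p + p ×ˢ z   ≡⟨ cong₂ _+_ (cong₂ _+_ (^ˢ≡^ a p) (^ˢ≡^ b p)) (×ˢ≡* p z) ⟩
    a ^ p + b ^ p + p * z      ∎)
    where open ≡-Reasoning

module PrimeModulus (p : ℕ) (pp : Prime p) where

  instance
    p-nonZero : NonZero p
    p-nonZero = prime⇒nonZero pp

  open ModularArithmetic p public
  open ≡-mod-Reasoning

  1<p : 1 < p
  1<p = nonTrivial⇒n>1 p {{prime⇒nonTrivial pp}}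

  0<p : 0 < p
  0<p = <-trans z<s 1<p

  fermat : ∀ a → a ^ p ≡ a mod p
  fermat zero    = ≡⇒≡-mod (sym (cong (0 ^_) (suc-pred p)))
  fermat (suc a) with frobeniusℕ pp a 1
  ... | z , eq = begin
    suc a ^ p               ≡⟨ cong (_^ p) (+-comm 1 a) ⟩
    (a + 1) ^ p             ≡⟨ eq ⟩
    a ^ p + 1 ^ p + p * z   ≈⟨ +-cong-mod (+-cong-mod (fermat a) (≡⇒≡-mod (^-zeroˡ p))) (m*x≡0-mod z) ⟩
    a + 1 + 0               ≡⟨ trans (+-identityʳ (a + 1)) (+-comm a 1) ⟩
    suc a                   ∎

  private
    cancel-≤ : ∀ {a u v} → ¬ p ∣ a → u ≤ v → v < p → a * u ≡ a * v mod p → u ≡ v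
    cancel-≤ {a} {u} {v} p∤a u≤v v<p au≡av with euclidsLemma a (v ∸ u) pp (≡0-mod⇒∣ a[v∸u]≡0)
      where
        a[v∸u]≡0 : a * (v ∸ u) ≡ 0 mod p
        a[v∸u]≡0 = +-cancelˡ-mod (a * u) (begin
          a * u + a * (v ∸ u)   ≡⟨ *-distribˡ-+ a u (v ∸ u) ⟨
          a * (u + (v ∸ u))     ≡⟨ cong (a *_) (m+[n∸m]≡n u≤v) ⟩
          a * v                 ≈⟨ au≡av ⟨
          a * u                 ≡⟨ +-identityʳ (a * u) ⟨
          a * u + 0             ∎)
    ... | inj₁ p∣a   = contradiction p∣a p∤a
    ... | inj₂ p∣v∸u = ≤-antisym u≤v (m∸n≡0⇒m≤n (∣∧<⇒≡0 p∣v∸u (≤-<-trans (m∸n≤m v u) v<p)))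

    a*%-cong : ∀ a x → a * (x % p) ≡ a * x mod p
    a*%-cong a x = *-cong-mod (≡-mod-refl {a}) (%-≡-mod x)

  *-cancelˡ-mod : ∀ {a x y} → ¬ p ∣ a → a * x ≡ a * y mod p → x ≡ y mod p
  *-cancelˡ-mod {a} {x} {y} p∤a ax≡ay with ≤-total (x % p) (y % p)
  ... | inj₁ x%p≤y%p = cancel-≤ p∤a x%p≤y%p (m%n<n y p)
                         (≡-mod-trans (a*%-cong a x) (≡-mod-trans ax≡ay (sym (a*%-cong a y))))
  ... | inj₂ y%p≤x%p = sym (cancel-≤ p∤a y%p≤x%p (m%n<n x p)
                         (≡-mod-trans (a*%-cong a y) (≡-mod-trans (sym ax≡ay) (sym (a*%-cong a x)))))

  fermat′ : ∀ {a} → ¬ p ∣ a → a ^ (p ∸ 1) ≡ 1 mod p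
  fermat′ {a} p∤a = *-cancelˡ-mod p∤a (begin
    a * a ^ (p ∸ 1)   ≡⟨ cong (a ^_) (suc-pred p) ⟩
    a ^ p             ≈⟨ fermat a ⟩
    a                 ≡⟨ *-identityʳ a ⟨
    a * 1             ∎)

-- The semiring of additive operators

module AdditiveOperators (D : Set) where

  open import Algebra.Structures using (IsSemiring)

  record AdditiveOperator : Set where
    field
      apply      : (D → ℕ) → (D → ℕ)
      apply-cong : ∀ {f g} → f ≗ g → apply f ≗ apply g
      apply-+    : ∀ f g → apply (λ x → f x + g x) ≗ λ x → apply f x + apply g x

  open AdditiveOperator public

  apply-0 : ∀ A → apply A (λ _ → 0) ≗ λ _ → 0
  apply-0 A x = +-cancelˡ-≡ a a 0 (trans (sym (apply-+ A (λ _ → 0) (λ _ → 0) x)) (sym (+-identityʳ a)))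
    where a = apply A (λ _ → 0) x

  infix  4 _≈ᵒ_
  infixl 6 _+ᵒ_
  infixl 7 _*ᵒ_

  _≈ᵒ_ : AdditiveOperator → AdditiveOperator → Set
  A ≈ᵒ B = ∀ f → apply A f ≗ apply B f

  _+ᵒ_ : AdditiveOperator → AdditiveOperator → AdditiveOperator
  A +ᵒ B = record
    { apply      = λ f x → apply A f x + apply B f x
    ; apply-cong = λ f≗g x → cong₂ _+_ (apply-cong A f≗g x) (apply-cong B f≗g x)
    ; apply-+    = λ f g x → trans (cong₂ _+_ (apply-+ A f g x) (apply-+ B f g x))
                                   (+-interchange (apply A f x) _ _ _)
    }
    where
      +-interchange : ∀ a b c d → (a + b) + (c + d) ≡ (a + c) + (b + d)
      +-interchange = solve-∀

  _*ᵒ_ : AdditiveOperator → AdditiveOperator → AdditiveOperator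
  A *ᵒ B = record
    { apply      = λ f → apply A (apply B f)
    ; apply-cong = λ f≗g → apply-cong A (apply-cong B f≗g)
    ; apply-+    = λ f g x → trans (apply-cong A (apply-+ B f g) x) (apply-+ A (apply B f) (apply B g) x)
    }

  0ᵒ : AdditiveOperator
  0ᵒ = record { apply = λ _ _ → 0 ; apply-cong = λ _ _ → refl ; apply-+ = λ _ _ _ → refl }

  1ᵒ : AdditiveOperator
  1ᵒ = record { apply = λ f → f ; apply-cong = λ f≗g → f≗g ; apply-+ = λ _ _ _ → refl }

  isSemiring : IsSemiring _≈ᵒ_ _+ᵒ_ _*ᵒ_ 0ᵒ 1ᵒ
  isSemiring = record
    { isSemiringWithoutAnnihilatingZero = record
      { +-isCommutativeMonoid = record
        { isMonoid = record
          { isSemigroup = record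
            { isMagma = record
              { isEquivalence = record
                { refl  = λ _ _ → refl
                ; sym   = λ A≈B f x → sym (A≈B f x)
                ; trans = λ A≈B B≈C f x → trans (A≈B f x) (B≈C f x)
                }
              ; ∙-cong = λ A≈A′ B≈B′ f x → cong₂ _+_ (A≈A′ f x) (B≈B′ f x)
              }
            ; assoc = λ A _ _ f x → +-assoc (apply A f x) _ _
            }
          ; identity = (λ _ _ _ → refl) , (λ A f x → +-identityʳ (apply A f x))
          }
        ; comm = λ A _ f x → +-comm (apply A f x) _
        }
      ; *-cong     = λ {A} {_} {_} {B′} A≈A′ B≈B′ f x → trans (apply-cong A (B≈B′ f) x) (A≈A′ (apply B′ f) x)
      ; *-assoc    = λ _ _ _ _ _ → refl
      ; *-identity = (λ _ _ _ → refl) , (λ _ _ _ → refl)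
      ; distrib    = (λ A B B′ f x → apply-+ A (apply B f) (apply B′ f) x) , (λ _ _ _ _ _ → refl)
      }
    ; zero = (λ _ _ _ → refl) , (λ A _ x → apply-0 A x)
    }

  semiring : Semiring 0ℓ 0ℓ
  semiring = record { isSemiring = isSemiring }

  open import Algebra.Definitions.RawSemiring (Semiring.rawSemiring semiring) public
    using () renaming (_^_ to _^ᵒ_; _×_ to _×ᵒ_)

  apply-×ᵒ : ∀ n A f x → apply (n ×ᵒ A) f x ≡ n * apply A f x
  apply-×ᵒ zero    A f x = refl
  apply-×ᵒ (suc n) A f x = cong (apply A f x +_) (apply-×ᵒ n A f x)

  apply-1ᵒ^ᵒ : ∀ n f x → apply (1ᵒ ^ᵒ n) f x ≡ f x
  apply-1ᵒ^ᵒ zero    f x = refl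
  apply-1ᵒ^ᵒ (suc n) f x = apply-1ᵒ^ᵒ n f x

  module _ {p} (pp : Prime p) where

    open PrimeModulus p pp

    frobeniusᵒ : ∀ {A B} → A *ᵒ B ≈ᵒ B *ᵒ A →
                 ∀ f x → apply ((A +ᵒ B) ^ᵒ p) f x ≡ apply (A ^ᵒ p) f x + apply (B ^ᵒ p) f x mod p
    frobeniusᵒ {A} {B} AB≈BA f x with Frobenius.frobenius semiring pp A B AB≈BA
    ... | z , eq = begin
      apply ((A +ᵒ B) ^ᵒ p) f x                                     ≡⟨ eq f x ⟩
      apply (A ^ᵒ p) f x + apply (B ^ᵒ p) f x + apply (p ×ᵒ z) f x  ≡⟨ cong (_ +_) (apply-×ᵒ p z f x) ⟩
      apply (A ^ᵒ p) f x + apply (B ^ᵒ p) f x + p * apply z f x     ≈⟨ +-cong-mod ≡-mod-refl (m*x≡0-mod _) ⟩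
      apply (A ^ᵒ p) f x + apply (B ^ᵒ p) f x + 0                   ≡⟨ +-identityʳ _ ⟩
      apply (A ^ᵒ p) f x + apply (B ^ᵒ p) f x                       ∎
      where open ≡-mod-Reasoning

-- Finite sums and densities

∑< : ℕ → (ℕ → ℕ) → ℕ
∑< zero    f = 0
∑< (suc n) f = f 0 + ∑< n (λ i → f (suc i))

syntax ∑< n (λ i → e) = ∑[ i < n ] e

∑-cong : ∀ n {f g} → (∀ i → i < n → f i ≡ g i) → ∑< n f ≡ ∑< n g
∑-cong zero    f≡g = refl
∑-cong (suc n) f≡g = cong₂ _+_ (f≡g 0 z<s) (∑-cong n (λ i i<n → f≡g (suc i) (s<s i<n)))

∑-mono-≤ : ∀ n {f g} → (∀ i → f i ≤ g i) → ∑< n f ≤ ∑< n g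
∑-mono-≤ zero    f≤g = z≤n
∑-mono-≤ (suc n) f≤g = +-mono-≤ (f≤g 0) (∑-mono-≤ n (λ i → f≤g (suc i)))

∑-last : ∀ n f → ∑< (suc n) f ≡ ∑< n f + f n
∑-last zero    f = +-comm (f 0) 0
∑-last (suc n) f = trans (cong (f 0 +_) (∑-last n (λ i → f (suc i)))) (sym (+-assoc (f 0) _ _))

∑-+ : ∀ m n f → ∑< (m + n) f ≡ ∑< m f + ∑[ i < n ] f (m + i)
∑-+ zero    n f = refl
∑-+ (suc m) n f = trans (cong (f 0 +_) (∑-+ m n (λ i → f (suc i)))) (sym (+-assoc (f 0) _ _))

∑-monoˡ-≤ : ∀ {m n} f → m ≤ n → ∑< m f ≤ ∑< n f
∑-monoˡ-≤ {m} {n} f m≤n = begin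
  ∑< m f                                ≤⟨ m≤m+n (∑< m f) _ ⟩
  ∑< m f + ∑[ i < n ∸ m ] f (m + i)     ≡⟨ ∑-+ m (n ∸ m) f ⟨
  ∑< (m + (n ∸ m)) f                    ≡⟨ cong (λ k → ∑< k f) (m+[n∸m]≡n m≤n) ⟩
  ∑< n f                                ∎
  where open ≤-Reasoning

∑-*ˡ : ∀ n c f → ∑[ i < n ] (c * f i) ≡ c * ∑< n f
∑-*ˡ zero    c f = sym (*-zeroʳ c)
∑-*ˡ (suc n) c f = trans (cong (c * f 0 +_) (∑-*ˡ n c (λ i → f (suc i)))) (sym (*-distribˡ-+ c (f 0) _))

∑-const : ∀ n c → ∑[ i < n ] c ≡ n * c
∑-const zero    c = refl
∑-const (suc n) c = cong (c +_) (∑-const n c)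

∑-blocks : ∀ N b f → ∑< (N * b) f ≡ ∑[ Y < N ] ∑[ r < b ] f (r + Y * b)
∑-blocks zero    b f = refl
∑-blocks (suc N) b f = begin
  ∑< (b + N * b) f                                                ≡⟨ ∑-+ b (N * b) f ⟩
  ∑< b f + ∑[ i < N * b ] f (b + i)                               ≡⟨ cong₂ _+_ lowest higher ⟩
  ∑[ r < b ] f (r + 0) + ∑[ Y < N ] ∑[ r < b ] f (r + suc Y * b)  ∎
  where
    open ≡-Reasoning
    lowest : ∑< b f ≡ ∑[ r < b ] f (r + 0)
    lowest = ∑-cong b (λ r _ → cong f (sym (+-identityʳ r)))
    higher : ∑[ i < N * b ] f (b + i) ≡ ∑[ Y < N ] ∑[ r < b ] f (r + suc Y * b)
    higher = trans (∑-blocks N b (λ i → f (b + i)))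
                   (∑-cong N (λ Y _ → ∑-cong b (λ r _ → cong f (x+[y+z]≡y+[x+z] b r (Y * b)))))
      where
        x+[y+z]≡y+[x+z] : ∀ x y z → x + (y + z) ≡ y + (x + z)
        x+[y+z]≡y+[x+z] = solve-∀

∑-%-/ : ∀ N b .{{_ : NonZero b}} g h → ∑[ n < N * b ] (g (n % b) * h (n / b)) ≡ ∑< b g * ∑< N h
∑-%-/ N b g h = begin
  ∑[ n < N * b ] (g (n % b) * h (n / b))                              ≡⟨ ∑-blocks N b _ ⟩
  ∑[ Y < N ] ∑[ r < b ] (g ((r + Y * b) % b) * h ((r + Y * b) / b))   ≡⟨ ∑-cong N (λ Y _ → ∑-cong b (λ r → digits r Y)) ⟩
  ∑[ Y < N ] ∑[ r < b ] (h Y * g r)                                   ≡⟨ ∑-cong N (λ Y _ → ∑-*ˡ b (h Y) g) ⟩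
  ∑[ Y < N ] (h Y * ∑< b g)                                           ≡⟨ ∑-cong N (λ Y _ → *-comm (h Y) _) ⟩
  ∑[ Y < N ] (∑< b g * h Y)                                           ≡⟨ ∑-*ˡ N (∑< b g) h ⟩
  ∑< b g * ∑< N h                                                     ∎
  where
    open ≡-Reasoning
    digits : ∀ r Y → r < b → g ((r + Y * b) % b) * h ((r + Y * b) / b) ≡ h Y * g r
    digits r Y r<b = trans (cong₂ (λ u v → g u * h v) [r+Yb]%b≡r [r+Yb]/b≡Y) (*-comm (g r) (h Y))
      where
        [r+Yb]%b≡r : (r + Y * b) % b ≡ r
        [r+Yb]%b≡r = trans ([m+kn]%n≡m%n r Y b) (m<n⇒m%n≡m r<b)
        [r+Yb]/b≡Y : (r + Y * b) / b ≡ Y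
        [r+Yb]/b≡Y = trans (+-distrib-/-∣ʳ r (n∣m*n Y)) (cong₂ _+_ (m<n⇒m/n≡0 r<b) (m*n/n≡m Y b))

fails : ∀ {A : Set} → Dec A → ℕ
fails A? = if does A? then 0 else 1

fails-yes : ∀ {A : Set} (A? : Dec A) → A → fails A? ≡ 0
fails-yes (yes _) _ = refl
fails-yes (no ¬a) a = contradiction a ¬a

fails-no : ∀ {A : Set} (A? : Dec A) → ¬ A → fails A? ≡ 1
fails-no (yes a) ¬a = contradiction a ¬a
fails-no (no _)  _  = refl

fails≡0⇒ : ∀ {A : Set} (A? : Dec A) → fails A? ≡ 0 → A
fails≡0⇒ (yes a) _ = a

fails≤1 : ∀ {A : Set} (A? : Dec A) → fails A? ≤ 1
fails≤1 (yes _) = z≤n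
fails≤1 (no _)  = ≤-refl

∑fails-≟ : ∀ {c n} → c < n → ∑[ r < n ] fails (r ≟ c) + 1 ≡ n
∑fails-≟ {zero}  {suc n} _         = trans (cong (_+ 1) (trans (∑-const n 1) (*-identityʳ n))) (+-comm n 1)
∑fails-≟ {suc c} {suc n} (s<s c<n) = cong suc (∑fails-≟ c<n)

module _ {P : Pred ℕ 0ℓ} (P? : Decidable P) where

  countBelow-step : ∀ N → countBelow P? (suc N) + fails (P? N) ≡ suc (countBelow P? N)
  countBelow-step N with P? N
  ... | yes _ = +-identityʳ _
  ... | no  _ = +-comm (countBelow P? N) 1

  countBelow+∑fails : ∀ N → countBelow P? N + ∑[ n < N ] fails (P? n) ≡ N
  countBelow+∑fails zero    = refl
  countBelow+∑fails (suc N) = begin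
    countBelow P? (suc N) + ∑[ n < suc N ] fails (P? n)                ≡⟨ cong (countBelow P? (suc N) +_) (∑-last N _) ⟩
    countBelow P? (suc N) + (∑[ n < N ] fails (P? n) + fails (P? N))   ≡⟨ x+[y+z]≡x+z+y (countBelow P? (suc N)) _ _ ⟩
    countBelow P? (suc N) + fails (P? N) + ∑[ n < N ] fails (P? n)     ≡⟨ cong (_+ ∑[ n < N ] fails (P? n)) (countBelow-step N) ⟩
    suc (countBelow P? N + ∑[ n < N ] fails (P? n))                    ≡⟨ cong suc (countBelow+∑fails N) ⟩
    suc N                                                              ∎
    where
      open ≡-Reasoning
      x+[y+z]≡x+z+y : ∀ x y z → x + (y + z) ≡ x + z + y
      x+[y+z]≡x+z+y = solve-∀

  ∸countBelow≡∑fails : ∀ N → N ∸ countBelow P? N ≡ ∑[ n < N ] fails (P? n)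
  ∸countBelow≡∑fails N = trans (cong (_∸ countBelow P? N) (sym (countBelow+∑fails N))) (m+n∸m≡n (countBelow P? N) _)

n<b^n : ∀ {b} → 1 < b → ∀ n → n < b ^ n
n<b^n 1<b zero    = z<s
n<b^n {b} 1<b@(s≤s (s≤s z≤n)) (suc n) = begin-strict
  suc n        ≤⟨ n<b^n 1<b n ⟩
  b ^ n        <⟨ m<m*n (b ^ n) b 1<b ⟩
  b ^ n * b    ≡⟨ *-comm (b ^ n) b ⟩
  b ^ suc n    ∎
  where
    open ≤-Reasoning
    instance
      b^n-nonZero : NonZero (b ^ n)
      b^n-nonZero = >-nonZero (m^n>0 b n)

power-bracket : ∀ {b} → 1 < b → ∀ {m₀ N} → b ^ m₀ ≤ N → ∃[ m ] (m₀ ≤ m × b ^ m ≤ N × N < b ^ suc m)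
power-bracket {b} 1<b {m₀} {N} b^m₀≤N = search (suc N) m₀ b^m₀≤N (m≤m+n (suc N) m₀)
  where
    search : ∀ fuel m → b ^ m ≤ N → N < fuel + m → ∃[ m′ ] (m ≤ m′ × b ^ m′ ≤ N × N < b ^ suc m′)
    search zero m b^m≤N N<m = contradiction b^m≤N (<⇒≱ (<-trans N<m (n<b^n 1<b m)))
    search (suc fuel) m b^m≤N N<1+fuel+m with b ^ suc m ≤? N
    ... | no  b^[1+m]≰N = m , ≤-refl , b^m≤N , ≰⇒> b^[1+m]≰N
    ... | yes b^[1+m]≤N with search fuel (suc m) b^[1+m]≤N (subst (N <_) (sym (+-suc fuel m)) N<1+fuel+m)
    ...   | m′ , 1+m≤m′ , b^m′≤N , N<b^[1+m′] = m′ , <⇒≤ 1+m≤m′ , b^m′≤N , N<b^[1+m′]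

-- (1 + 1/a)ᵐ ≥ 1 + m/a, cleared of denominators.
bernoulli : ∀ a m → a ^ m * (a + m) ≤ a * suc a ^ m
bernoulli a zero    = ≤-reflexive (trans (+-identityʳ (a + 0)) (trans (+-identityʳ a) (sym (*-identityʳ a))))
bernoulli a (suc m) = begin
  a * a ^ m * (a + suc m)                ≤⟨ m≤m+n _ (a ^ m * m) ⟩
  a * a ^ m * (a + suc m) + a ^ m * m    ≡⟨ regroup a (a ^ m) m ⟩
  suc a * (a ^ m * (a + m))              ≤⟨ *-monoʳ-≤ (suc a) (bernoulli a m) ⟩
  suc a * (a * suc a ^ m)                ≡⟨ x*[y*z]≡y*[x*z] (suc a) a (suc a ^ m) ⟩
  a * (suc a * suc a ^ m)                ∎
  where
    open ≤-Reasoning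
    regroup : ∀ a x m → a * x * (a + suc m) + x * m ≡ suc a * (x * (a + m))
    regroup = solve-∀
    x*[y*z]≡y*[x*z] : ∀ x y z → x * (y * z) ≡ y * (x * z)
    x*[y*z]≡y*[x*z] = solve-∀

K*a^m≤[1+a]^m : ∀ {a K m} → 1 ≤ a → K * a ≤ m → K * a ^ m ≤ suc a ^ m
K*a^m≤[1+a]^m {a@(suc _)} {K} {m} _ Ka≤m = *-cancelˡ-≤ a (begin
  a * (K * a ^ m)    ≡⟨ x*[y*z]≡z*[y*x] a K (a ^ m) ⟩
  a ^ m * (K * a)    ≤⟨ *-monoʳ-≤ (a ^ m) (≤-trans Ka≤m (m≤n+m m a)) ⟩
  a ^ m * (a + m)    ≤⟨ bernoulli a m ⟩
  a * suc a ^ m      ∎)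
  where
    open ≤-Reasoning
    x*[y*z]≡z*[y*x] : ∀ x y z → x * (y * z) ≡ z * (y * x)
    x*[y*z]≡z*[y*x] = solve-∀

density-from-bound : ∀ {P : Pred ℕ 0ℓ} (P? : Decidable P) {c b} .{{_ : NonZero c}} → 1 < b →
                     (∀ m → ∑[ n < b ^ m * c ] fails (P? n) ≤ c * (b ∸ 1) ^ m) → HasDensityOne P?
density-from-bound P? {c} {b} 1<b bound k _ = b ^ (K * a) , few-failures
  where
    a = b ∸ 1
    K = k * c * a
    few-failures : ∀ N → N ≥ b ^ (K * a) → k * (N ∸ countBelow P? N) ≤ N
    few-failures N N≥b^Ka with power-bracket 1<b {K * a} N≥b^Ka
    ... | m , Ka≤m , b^m≤N , N<b^[1+m] = begin
      k * (N ∸ countBelow P? N)                ≡⟨ cong (k *_) (∸countBelow≡∑fails P? N) ⟩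
      k * ∑[ n < N ] fails (P? n)              ≤⟨ *-monoʳ-≤ k (∑-monoˡ-≤ _ N≤b^[1+m]c) ⟩
      k * ∑[ n < b ^ suc m * c ] fails (P? n)  ≤⟨ *-monoʳ-≤ k (bound (suc m)) ⟩
      k * (c * a ^ suc m)                      ≡⟨ regroup k c a (a ^ m) ⟩
      K * a ^ m                                ≤⟨ K*a^m≤[1+a]^m {a} {K} (∸-monoˡ-≤ 1 1<b) Ka≤m ⟩
      suc a ^ m                                ≡⟨ cong (_^ m) (m+[n∸m]≡n (<⇒≤ 1<b)) ⟩
      b ^ m                                    ≤⟨ b^m≤N ⟩
      N                                        ∎
      where
        open ≤-Reasoning
        N≤b^[1+m]c : N ≤ b ^ suc m * c
        N≤b^[1+m]c = ≤-trans (<⇒≤ N<b^[1+m]) (m≤m*n (b ^ suc m) c)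
        regroup : ∀ k c a x → k * (c * (a * x)) ≡ k * c * a * x
        regroup = solve-∀

module _ {s : ℕ → ℕ} {i g : ℕ} (sᵢ≢0 : s i ≢ 0)
         (recur : ∀ j → OccursAt s i 1 j → ∃[ k ] (j < k × k ≤ j + g × OccursAt s i 1 k)) where

  private
    zeros? : Decidable (λ n → s n ≡ 0)
    zeros? n = s n ≟ 0

  occurrence-nonzero : ∀ {o} → OccursAt s i 1 o → fails (zeros? o) ≡ 1
  occurrence-nonzero {o} occ = fails-no (zeros? o) (λ sₒ≡0 → sᵢ≢0 (begin
    s i        ≡⟨ cong s (+-identityʳ i) ⟨
    s (i + 0)  ≡⟨ occ 0 z<s ⟨
    s (o + 0)  ≡⟨ cong s (+-identityʳ o) ⟩
    s o        ≡⟨ sₒ≡0 ⟩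
    0          ∎))
    where open ≡-Reasoning

  occurrences : ∀ t → ∃[ o ] (t ≤ o × o ≤ i + t * g × OccursAt s i 1 o × suc t ≤ ∑[ n < suc o ] fails (zeros? n))
  occurrences zero = i , z≤n , m≤m+n i 0 , (λ _ _ → refl) , (begin
    1                                                ≡⟨ occurrence-nonzero {i} (λ _ _ → refl) ⟨
    fails (zeros? i)                                 ≤⟨ m≤n+m _ _ ⟩
    ∑[ n < i ] fails (zeros? n) + fails (zeros? i)   ≡⟨ ∑-last i _ ⟨
    ∑[ n < suc i ] fails (zeros? n)                  ∎)
    where open ≤-Reasoning
  occurrences (suc t) with occurrences t
  ... | o , t≤o , o≤i+tg , occ , 1+t≤count with recur o occ
  ...   | k , o<k , k≤o+g , occ′ = k , ≤-trans (s≤s t≤o) o<k , k≤i+[1+t]g , occ′ , (begin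
    suc (suc t)                                          ≡⟨ +-comm 1 (suc t) ⟩
    suc t + 1                                            ≤⟨ +-mono-≤ 1+t≤count (≤-reflexive (sym (occurrence-nonzero occ′))) ⟩
    ∑[ n < suc o ] fails (zeros? n) + fails (zeros? k)   ≤⟨ +-monoˡ-≤ _ (∑-monoˡ-≤ _ o<k) ⟩
    ∑[ n < k ] fails (zeros? n) + fails (zeros? k)       ≡⟨ ∑-last k _ ⟨
    ∑[ n < suc k ] fails (zeros? n)                      ∎)
    where
      open ≤-Reasoning
      k≤i+[1+t]g : k ≤ i + suc t * g
      k≤i+[1+t]g = begin
        k              ≤⟨ k≤o+g ⟩
        o + g          ≤⟨ +-monoˡ-≤ g o≤i+tg ⟩
        i + t * g + g  ≡⟨ regroup i t g ⟩
        i + suc t * g  ∎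
        where
          regroup : ∀ i t g → i + t * g + g ≡ i + suc t * g
          regroup = solve-∀

-- The occurrences of the one-letter factor s i have gaps at most g, so the non-zeros of s
-- have lower density at least 1/g.
uniformlyRecurrent⇒¬densityOne : ∀ {s} → UniformlyRecurrent s → ∀ i → s i ≢ 0 → ¬ HasDensityOne (λ n → s n ≟ 0)
uniformlyRecurrent⇒¬densityOne {s} recurrent i sᵢ≢0 dense with recurrent i 1
... | g , recur with dense (suc g) (s≤s z≤n)
...   | N₀ , sparse with occurrences {s} sᵢ≢0 recur (N₀ + suc i)
...     | o , t≤o , o≤i+tg , _ , 1+t≤count =
  <⇒≱ i<t (≤-trans (m≤m+n t g) (+-cancelˡ-≤ (t * g) (t + g) i (s≤s⁻¹ (begin
    suc (t * g + (t + g))                                 ≡⟨ expand t g ⟩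
    suc g * suc t                                         ≤⟨ *-monoʳ-≤ (suc g) 1+t≤count ⟩
    suc g * ∑[ n < suc o ] fails (s n ≟ 0)                ≡⟨ cong (suc g *_) (∸countBelow≡∑fails (λ n → s n ≟ 0) (suc o)) ⟨
    suc g * (suc o ∸ countBelow (λ n → s n ≟ 0) (suc o))  ≤⟨ sparse (suc o) N₀≤1+o ⟩
    suc o                                                 ≤⟨ s≤s o≤i+tg ⟩
    suc (i + t * g)                                       ≡⟨ cong suc (+-comm i (t * g)) ⟩
    suc (t * g + i)                                       ∎))))
  where
    open ≤-Reasoning
    t = N₀ + suc i
    i<t : i < t
    i<t = ≤-trans (n<1+n i) (m≤n+m (suc i) N₀)
    N₀≤1+o : N₀ ≤ suc o
    N₀≤1+o = ≤-trans (m≤m+n N₀ (suc i)) (≤-trans t≤o (n≤1+n o))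
    expand : ∀ t g → suc (t * g + (t + g)) ≡ suc g * suc t
    expand = solve-∀

-- Base-b digits

module _ (b : ℕ) .{{_ : NonZero b}} where

  split-lowest-digit : ∀ n X L → n + X * b ^ suc L ≡ n % b + (n / b + X * b ^ L) * b
  split-lowest-digit n X L = trans (cong (_+ X * b ^ suc L) (m≡m%n+[m/n]*n n b)) (regroup (n % b) (n / b) X b (b ^ L))
    where
      regroup : ∀ r q X b y → r + q * b + X * (b * y) ≡ r + (q + X * y) * b
      regroup = solve-∀

  quotient-< : ∀ {n} L → n < b ^ suc L → n / b < b ^ L
  quotient-< {n} L n<b^[1+L] = m<n*o⇒m/o<n (subst (n <_) (*-comm b (b ^ L)) n<b^[1+L])

  digits-< : ∀ {x W} k l → x < b ^ k → W < b ^ l → x + W * b ^ k < b ^ (k + l)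
  digits-< {x} {W} k l x<b^k W<b^l = begin-strict
    x + W * b ^ k       <⟨ +-monoˡ-< (W * b ^ k) x<b^k ⟩
    suc W * b ^ k       ≤⟨ *-monoˡ-≤ (b ^ k) W<b^l ⟩
    b ^ l * b ^ k       ≡⟨ *-comm (b ^ l) (b ^ k) ⟩
    b ^ k * b ^ l       ≡⟨ ^-distribˡ-+-* b k l ⟨
    b ^ (k + l)         ∎
    where open ≤-Reasoning

module _ (W : ℕ) .{{_ : NonZero W}} where

  next-multiple : ∀ x {c} → c ≤ W → x < c + suc (x / W) * W × c + suc (x / W) * W ≤ x + 2 * W
  next-multiple x {c} c≤W = above , below
    where
      above : x < c + suc (x / W) * W
      above = begin-strict
        x                    ≡⟨ m≡m%n+[m/n]*n x W ⟩
        x % W + x / W * W    <⟨ +-monoˡ-< (x / W * W) (m%n<n x W) ⟩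
        suc (x / W) * W      ≤⟨ m≤n+m _ c ⟩
        c + suc (x / W) * W  ∎
        where open ≤-Reasoning
      below : c + suc (x / W) * W ≤ x + 2 * W
      below = begin
        c + (W + x / W * W)  ≤⟨ +-mono-≤ c≤W (+-monoʳ-≤ W (m/n*n≤m x W)) ⟩
        W + (W + x)          ≡⟨ regroup W x ⟩
        x + 2 * W            ∎
        where
          open ≤-Reasoning
          regroup : ∀ W x → W + (W + x) ≡ x + 2 * W
          regroup = solve-∀

  scaled-window : ∀ {j y D} i → j / W < y → y ≤ j / W + D → j < i + y * W × i + y * W ≤ j + (i + D * W)
  scaled-window {j} {y} {D} i j/W<y y≤j/W+D = above , below
    where
      above : j < i + y * W
      above = begin-strict
        j                    ≡⟨ m≡m%n+[m/n]*n j W ⟩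
        j % W + j / W * W    <⟨ +-monoˡ-< (j / W * W) (m%n<n j W) ⟩
        suc (j / W) * W      ≤⟨ *-monoˡ-≤ W j/W<y ⟩
        y * W                ≤⟨ m≤n+m (y * W) i ⟩
        i + y * W            ∎
        where open ≤-Reasoning
      below : i + y * W ≤ j + (i + D * W)
      below = begin
        i + y * W                ≤⟨ +-monoʳ-≤ i (*-monoˡ-≤ W y≤j/W+D) ⟩
        i + (j / W + D) * W      ≡⟨ regroup i (j / W) D W ⟩
        j / W * W + (i + D * W)  ≤⟨ +-monoˡ-≤ (i + D * W) (m/n*n≤m j W) ⟩
        j + (i + D * W)          ∎
        where
          open ≤-Reasoning
          regroup : ∀ i x D W → i + (x + D) * W ≡ x * W + (i + D * W)
          regroup = solve-∀

-- Trinomial coefficients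

import Data.Integer as ℤ
open ℤ using (ℤ; +_; -[1+_]; 0ℤ; 1ℤ; -1ℤ)
import Data.Integer.Properties as ℤₚ
import Data.Integer.Tactic.RingSolver as ℤ-Solver

open AdditiveOperators ℤ

shift : ℤ → AdditiveOperator
shift c = record
  { apply      = λ f k → f (k ℤ.+ c)
  ; apply-cong = λ f≗g k → f≗g (k ℤ.+ c)
  ; apply-+    = λ _ _ _ → refl
  }

apply-shift^ᵒ : ∀ c n f k → apply (shift c ^ᵒ n) f k ≡ f (k ℤ.+ + n ℤ.* c)
apply-shift^ᵒ c zero    f k = cong f (sym (ℤₚ.+-identityʳ k))
apply-shift^ᵒ c (suc n) f k = trans (apply-shift^ᵒ c n f (k ℤ.+ c)) (cong f (regroup k c (+ n)))
  where
    regroup : ∀ k c n → k ℤ.+ c ℤ.+ n ℤ.* c ≡ k ℤ.+ (1ℤ ℤ.+ n) ℤ.* c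
    regroup = ℤ-Solver.solve-∀

-- Multiplication by x⁻¹ + 1 + x, acting on coefficient sequences.
trinomial : AdditiveOperator
trinomial = shift -1ℤ +ᵒ 1ᵒ +ᵒ shift 1ℤ

coeff-+ : ∀ m n → coeff (m + n) ≗ apply (trinomial ^ᵒ m) (coeff n)
coeff-+ zero    n k = refl
coeff-+ (suc m) n k =
  cong₂ _+_ (cong₂ _+_ (coeff-+ m n (k ℤ.+ -1ℤ)) (coeff-+ m n k)) (coeff-+ m n (k ℤ.+ 1ℤ))

coeff0-≢ : ∀ {k} → k ≢ 0ℤ → coeff 0 k ≡ 0
coeff0-≢ {k} k≢0 with k ℤ.≟ 0ℤ
... | yes k≡0 = contradiction k≡0 k≢0
... | no  _   = refl

coeff-outside : ∀ n k → n < ℤ.∣ k ∣ → coeff n k ≡ 0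
coeff-outside zero    k 0<∣k∣ = coeff0-≢ (λ k≡0 → <⇒≢ 0<∣k∣ (sym (cong ℤ.∣_∣ k≡0)))
coeff-outside (suc n) k 1+n<∣k∣ =
  cong₂ _+_ (cong₂ _+_ (coeff-outside n (k ℤ.+ -1ℤ) (neighbour -1ℤ refl))
                       (coeff-outside n k (<-trans (n<1+n n) 1+n<∣k∣)))
            (coeff-outside n (k ℤ.+ 1ℤ) (neighbour 1ℤ refl))
  where
    neighbour : ∀ c → ℤ.∣ c ∣ ≡ 1 → n < ℤ.∣ k ℤ.+ c ∣
    neighbour c ∣c∣≡1 = s<s⁻¹ (begin-strict
      suc n                          <⟨ 1+n<∣k∣ ⟩
      ℤ.∣ k ∣                        ≡⟨ cong ℤ.∣_∣ (+-cancel k c) ⟩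
      ℤ.∣ k ℤ.+ c ℤ.+ ℤ.- c ∣        ≤⟨ ℤₚ.∣i+j∣≤∣i∣+∣j∣ (k ℤ.+ c) (ℤ.- c) ⟩
      ℤ.∣ k ℤ.+ c ∣ + ℤ.∣ ℤ.- c ∣    ≡⟨ cong₂ _+_ refl (trans (ℤₚ.∣-i∣≡∣i∣ c) ∣c∣≡1) ⟩
      ℤ.∣ k ℤ.+ c ∣ + 1              ≡⟨ +-comm _ 1 ⟩
      suc ℤ.∣ k ℤ.+ c ∣              ∎)
      where
        open ≤-Reasoning
        +-cancel : ∀ k c → k ≡ k ℤ.+ c ℤ.+ ℤ.- c
        +-cancel = ℤ-Solver.solve-∀

coeff-sym : ∀ n k → coeff n (ℤ.- k) ≡ coeff n k
coeff-sym zero k with k ℤ.≟ 0ℤ | ℤ.- k ℤ.≟ 0ℤ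
... | yes _   | yes _    = refl
... | no  _   | no  _    = refl
... | yes k≡0 | no -k≢0  = contradiction (cong ℤ.-_ k≡0) -k≢0
... | no  k≢0 | yes -k≡0 = contradiction (trans (sym (ℤₚ.neg-involutive k)) (cong ℤ.-_ -k≡0)) k≢0
coeff-sym (suc n) k = begin
  coeff n (ℤ.- k ℤ.+ -1ℤ) + coeff n (ℤ.- k) + coeff n (ℤ.- k ℤ.+ 1ℤ)
    ≡⟨ cong₂ _+_ (cong₂ _+_ (reflect (k ℤ.+ 1ℤ) (-k-1 k)) (coeff-sym n k)) (reflect (k ℤ.+ -1ℤ) (-k+1 k)) ⟩
  coeff n (k ℤ.+ 1ℤ) + coeff n k + coeff n (k ℤ.+ -1ℤ)
    ≡⟨ +-reverse (coeff n (k ℤ.+ 1ℤ)) _ _ ⟩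
  coeff n (k ℤ.+ -1ℤ) + coeff n k + coeff n (k ℤ.+ 1ℤ) ∎
  where
    open ≡-Reasoning
    reflect : ∀ {i} j → i ≡ ℤ.- j → coeff n i ≡ coeff n j
    reflect j refl = coeff-sym n j
    -k-1 : ∀ k → ℤ.- k ℤ.+ -1ℤ ≡ ℤ.- (k ℤ.+ 1ℤ)
    -k-1 = ℤ-Solver.solve-∀
    -k+1 : ∀ k → ℤ.- k ℤ.+ 1ℤ ≡ ℤ.- (k ℤ.+ -1ℤ)
    -k+1 = ℤ-Solver.solve-∀
    +-reverse : ∀ a b c → a + b + c ≡ c + b + a
    +-reverse = solve-∀

-- The reflection principle.
paths+coeff≡coeff : ∀ n h → paths n h + coeff n (+ (2 + h)) ≡ coeff n (+ h)
paths+coeff≡coeff zero    zero    = refl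
paths+coeff≡coeff zero    (suc h) = refl
paths+coeff≡coeff (suc n) zero    = begin
  paths n 1 + paths n 0 + (c 1 + c 2 + c 3)      ≡⟨ regroup (paths n 1) (paths n 0) (c 1) (c 2) (c 3) ⟩
  (paths n 1 + c 3) + (paths n 0 + c 2) + c 1    ≡⟨ cong₂ (λ u v → u + v + c 1) (paths+coeff≡coeff n 1) (paths+coeff≡coeff n 0) ⟩
  c 1 + c 0 + c 1                                ≡⟨ cong (λ u → u + c 0 + c 1) (coeff-sym n 1ℤ) ⟨
  coeff n -1ℤ + c 0 + c 1                        ∎
  where
    open ≡-Reasoning
    c : ℕ → ℕ
    c i = coeff n (+ i)
    regroup : ∀ a b x y z → a + b + (x + y + z) ≡ (a + z) + (b + y) + x
    regroup = solve-∀
paths+coeff≡coeff (suc n) (suc h) = begin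
  paths n (2 + h) + paths n (1 + h) + paths n h + (c (2 + h) + c (3 + h) + c (3 + h + 1))
    ≡⟨ cong (λ i → paths n (2 + h) + paths n (1 + h) + paths n h + (c (2 + h) + c (3 + h) + c i)) (+-comm (3 + h) 1) ⟩
  paths n (2 + h) + paths n (1 + h) + paths n h + (c (2 + h) + c (3 + h) + c (4 + h))
    ≡⟨ regroup (paths n (2 + h)) (paths n (1 + h)) (paths n h) _ _ _ ⟩
  (paths n h + c (2 + h)) + (paths n (1 + h) + c (3 + h)) + (paths n (2 + h) + c (4 + h))
    ≡⟨ cong₂ _+_ (cong₂ _+_ (paths+coeff≡coeff n h) (paths+coeff≡coeff n (1 + h))) (paths+coeff≡coeff n (2 + h)) ⟩
  c h + c (1 + h) + c (2 + h)
    ≡⟨ cong (λ i → c h + c (1 + h) + c i) (+-comm (1 + h) 1) ⟨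
  c h + c (1 + h) + c (1 + h + 1) ∎
  where
    open ≡-Reasoning
    c : ℕ → ℕ
    c i = coeff n (+ i)
    regroup : ∀ a b d x y z → a + b + d + (x + y + z) ≡ (d + x) + (b + y) + (a + z)
    regroup = solve-∀

Motzkin+coeff₂≡T : ∀ n → Motzkin n + coeff n (+ 2) ≡ T n
Motzkin+coeff₂≡T n = paths+coeff≡coeff n 0

module _ {p : ℕ} (pp : Prime p) where

  open PrimeModulus p pp
  open ≡-mod-Reasoning

  apply-trinomial^p : ∀ f k → apply (trinomial ^ᵒ p) f k ≡ f (k ℤ.- + p) + f k + f (k ℤ.+ + p) mod p
  apply-trinomial^p f k = begin
    apply (trinomial ^ᵒ p) f k
      ≈⟨ frobeniusᵒ pp {shift -1ℤ +ᵒ 1ᵒ} {shift 1ℤ} shifts-commute f k ⟩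
    apply ((shift -1ℤ +ᵒ 1ᵒ) ^ᵒ p) f k + apply (shift 1ℤ ^ᵒ p) f k
      ≈⟨ +-cong-mod (frobeniusᵒ pp {shift -1ℤ} {1ᵒ} (λ _ _ → refl) f k) ≡-mod-refl ⟩
    apply (shift -1ℤ ^ᵒ p) f k + apply (1ᵒ ^ᵒ p) f k + apply (shift 1ℤ ^ᵒ p) f k
      ≡⟨ cong₂ _+_ (cong₂ _+_ (apply-shift^ᵒ -1ℤ p f k) (apply-1ᵒ^ᵒ p f k)) (apply-shift^ᵒ 1ℤ p f k) ⟩
    f (k ℤ.+ + p ℤ.* -1ℤ) + f k + f (k ℤ.+ + p ℤ.* 1ℤ)
      ≡⟨ cong₂ (λ i j → f i + f k + f j) (times-1 k (+ p)) (times1 k (+ p)) ⟩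
    f (k ℤ.- + p) + f k + f (k ℤ.+ + p) ∎
    where
      shifts-commute : (shift -1ℤ +ᵒ 1ᵒ) *ᵒ shift 1ℤ ≈ᵒ shift 1ℤ *ᵒ (shift -1ℤ +ᵒ 1ᵒ)
      shifts-commute f k = cong (λ i → f i + f (k ℤ.+ 1ℤ)) (swap k)
        where
          swap : ∀ k → k ℤ.+ -1ℤ ℤ.+ 1ℤ ≡ k ℤ.+ 1ℤ ℤ.+ -1ℤ
          swap = ℤ-Solver.solve-∀
      times-1 : ∀ k n → k ℤ.+ n ℤ.* -1ℤ ≡ k ℤ.- n
      times-1 = ℤ-Solver.solve-∀
      times1 : ∀ k n → k ℤ.+ n ℤ.* 1ℤ ≡ k ℤ.+ n
      times1 = ℤ-Solver.solve-∀

  coeff-p+ : ∀ n k → coeff (p + n) k ≡ coeff n (k ℤ.- + p) + coeff n k + coeff n (k ℤ.+ + p) mod p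
  coeff-p+ n k = ≡-mod-trans (≡⇒≡-mod (coeff-+ p n k)) (apply-trinomial^p (coeff n) k)

-- Lucas-type congruences

module LucasCongruence {p : ℕ} (pp : Prime p) where

  open PrimeModulus p pp public

  P : ℤ
  P = + p

  private
    x*1+y*0 : ∀ x y → x ≡ x * 1 + y * 0
    x*1+y*0 = solve-∀
    x*0+y*1 : ∀ x y → y ≡ x * 0 + y * 1
    x*0+y*1 = solve-∀
    x*0+y*0 : ∀ x y → 0 ≡ x * 0 + y * 0
    x*0+y*0 = solve-∀

  -- For r < p and a ≤ p the only multiples b p with |b p + a| ≤ r are 0 and -p.
  coeff-digit-base : ∀ {r a} b → r < p → a ≤ p →
                coeff r (b ℤ.* P ℤ.+ + a) ≡ coeff r (+ a) * coeff 0 b + coeff r (+ a ℤ.- P) * coeff 0 (b ℤ.+ 1ℤ)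
  coeff-digit-base {r} {a} (+ zero) r<p a≤p = x*1+y*0 (coeff r (+ a)) (coeff r (+ a ℤ.- P))
  coeff-digit-base {r} {a} -[1+ zero ] r<p a≤p =
    trans (cong (coeff r) -P+a) (x*0+y*1 (coeff r (+ a)) (coeff r (+ a ℤ.- P)))
    where
      -P+a : -1ℤ ℤ.* P ℤ.+ + a ≡ + a ℤ.- P
      -P+a = trans (cong (ℤ._+ + a) (ℤₚ.-1*i≡-i P)) (ℤₚ.+-comm (ℤ.- P) (+ a))
  coeff-digit-base {r} {a} (+ suc c) r<p a≤p =
    trans (coeff-outside r _ (subst (r <_) (sym ∣k∣≡) (<-≤-trans r<p (≤-trans (m≤m+n p (c * p)) (m≤m+n _ a)))))
          (x*0+y*0 (coeff r (+ a)) (coeff r (+ a ℤ.- P)))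
    where
      ∣k∣≡ : ℤ.∣ + suc c ℤ.* P ℤ.+ + a ∣ ≡ suc c * p + a
      ∣k∣≡ = cong (λ i → ℤ.∣ i ℤ.+ + a ∣) (sym (ℤₚ.pos-* (suc c) p))
  coeff-digit-base {r} {a} -[1+ suc c ] r<p a≤p =
    trans (coeff-outside r _ (<-≤-trans r<p p≤∣k∣))
          (x*0+y*0 (coeff r (+ a)) (coeff r (+ a ℤ.- P)))
    where
      k = -[1+ suc c ] ℤ.* P ℤ.+ + a
      p≤∣k∣ : p ≤ ℤ.∣ k ∣
      p≤∣k∣ = +-cancelʳ-≤ p p ℤ.∣ k ∣ (begin
        p + p                           ≤⟨ +-monoʳ-≤ p (m≤m+n p (c * p)) ⟩
        suc (suc c) * p                 ≡⟨ ℤₚ.abs-* -[1+ suc c ] P ⟨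
        ℤ.∣ -[1+ suc c ] ℤ.* P ∣        ≡⟨ cong ℤ.∣_∣ (+-cancel (-[1+ suc c ] ℤ.* P) (+ a)) ⟩
        ℤ.∣ k ℤ.+ ℤ.- + a ∣             ≤⟨ ℤₚ.∣i+j∣≤∣i∣+∣j∣ k (ℤ.- + a) ⟩
        ℤ.∣ k ∣ + ℤ.∣ ℤ.- + a ∣         ≡⟨ cong₂ _+_ refl (ℤₚ.∣-i∣≡∣i∣ (+ a)) ⟩
        ℤ.∣ k ∣ + a                     ≤⟨ +-monoʳ-≤ ℤ.∣ k ∣ a≤p ⟩
        ℤ.∣ k ∣ + p                     ∎)
        where
          open ≤-Reasoning
          +-cancel : ∀ x y → x ≡ x ℤ.+ y ℤ.+ ℤ.- y
          +-cancel = ℤ-Solver.solve-∀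

  coeff-digit : ∀ {r a} X b → r < p → a ≤ p →
    coeff (r + X * p) (b ℤ.* P ℤ.+ + a) ≡ coeff r (+ a) * coeff X b + coeff r (+ a ℤ.- P) * coeff X (b ℤ.+ 1ℤ) mod p
  coeff-digit {r} {a} zero b r<p a≤p =
    ≡⇒≡-mod (trans (cong (λ n → coeff n (b ℤ.* P ℤ.+ + a)) (+-identityʳ r)) (coeff-digit-base b r<p a≤p))
  coeff-digit {r} {a} (suc X) b r<p a≤p = begin
    coeff (r + (p + X * p)) (k b)
      ≡⟨ cong (λ m → coeff m (k b)) (x+[y+z]≡y+[x+z] r p (X * p)) ⟩
    coeff (p + n) (k b)
      ≈⟨ coeff-p+ pp n (k b) ⟩
    coeff n (k b ℤ.- P) + coeff n (k b) + coeff n (k b ℤ.+ P)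
      ≡⟨ cong₂ (λ i j → coeff n i + coeff n (k b) + coeff n j) (k-P b) (k+P b) ⟩
    coeff n (k (b ℤ.+ -1ℤ)) + coeff n (k b) + coeff n (k (b ℤ.+ 1ℤ))
      ≈⟨ +-cong-mod (+-cong-mod (IH (b ℤ.+ -1ℤ)) (IH b)) (IH (b ℤ.+ 1ℤ)) ⟩
    (α * c (b ℤ.+ -1ℤ) + β * c (b ℤ.+ -1ℤ ℤ.+ 1ℤ)) + (α * c b + β * c (b ℤ.+ 1ℤ))
      + (α * c (b ℤ.+ 1ℤ) + β * c (b ℤ.+ 1ℤ ℤ.+ 1ℤ))
      ≡⟨ cong (λ i → (α * c (b ℤ.+ -1ℤ) + β * c i) + (α * c b + β * c (b ℤ.+ 1ℤ))
                      + (α * c (b ℤ.+ 1ℤ) + β * c (b ℤ.+ 1ℤ ℤ.+ 1ℤ))) (-1+1 b) ⟩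
    (α * c (b ℤ.+ -1ℤ) + β * c b) + (α * c b + β * c (b ℤ.+ 1ℤ))
      + (α * c (b ℤ.+ 1ℤ) + β * c (b ℤ.+ 1ℤ ℤ.+ 1ℤ))
      ≡⟨ regroup α β (c (b ℤ.+ -1ℤ)) (c b) (c (b ℤ.+ 1ℤ)) (c (b ℤ.+ 1ℤ ℤ.+ 1ℤ)) ⟩
    α * (c (b ℤ.+ -1ℤ) + c b + c (b ℤ.+ 1ℤ)) + β * (c b + c (b ℤ.+ 1ℤ) + c (b ℤ.+ 1ℤ ℤ.+ 1ℤ))
      ≡⟨ cong (λ i → α * coeff (suc X) b + β * (c i + c (b ℤ.+ 1ℤ) + c (b ℤ.+ 1ℤ ℤ.+ 1ℤ))) (+1-1 b) ⟨
    α * coeff (suc X) b + β * coeff (suc X) (b ℤ.+ 1ℤ) ∎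
    where
      open ≡-mod-Reasoning
      n = r + X * p
      k : ℤ → ℤ
      k b = b ℤ.* P ℤ.+ + a
      α = coeff r (+ a)
      β = coeff r (+ a ℤ.- P)
      c = coeff X
      IH : ∀ b → coeff n (k b) ≡ α * c b + β * c (b ℤ.+ 1ℤ) mod p
      IH b = coeff-digit X b r<p a≤p
      x+[y+z]≡y+[x+z] : ∀ x y z → x + (y + z) ≡ y + (x + z)
      x+[y+z]≡y+[x+z] = solve-∀
      k-P : ∀ b → b ℤ.* P ℤ.+ + a ℤ.- P ≡ (b ℤ.+ -1ℤ) ℤ.* P ℤ.+ + a
      k-P b = ring b P (+ a)
        where ring : ∀ b P A → b ℤ.* P ℤ.+ A ℤ.- P ≡ (b ℤ.+ -1ℤ) ℤ.* P ℤ.+ A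
              ring = ℤ-Solver.solve-∀
      k+P : ∀ b → b ℤ.* P ℤ.+ + a ℤ.+ P ≡ (b ℤ.+ 1ℤ) ℤ.* P ℤ.+ + a
      k+P b = ring b P (+ a)
        where ring : ∀ b P A → b ℤ.* P ℤ.+ A ℤ.+ P ≡ (b ℤ.+ 1ℤ) ℤ.* P ℤ.+ A
              ring = ℤ-Solver.solve-∀
      -1+1 : ∀ b → b ℤ.+ -1ℤ ℤ.+ 1ℤ ≡ b
      -1+1 = ℤ-Solver.solve-∀
      +1-1 : ∀ b → b ℤ.+ 1ℤ ℤ.+ -1ℤ ≡ b
      +1-1 = ℤ-Solver.solve-∀
      regroup : ∀ α β x y z w → (α * x + β * y) + (α * y + β * z) + (α * z + β * w)
                                ≡ α * (x + y + z) + β * (y + z + w)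
      regroup = solve-∀

  T₁ : ℕ → ℕ
  T₁ n = coeff n 1ℤ

  coeff-digit₀ : ∀ {r a} X → r < p → a ≤ p →
    coeff (r + X * p) (+ a) ≡ coeff r (+ a) * T X + coeff r (+ a ℤ.- P) * T₁ X mod p
  coeff-digit₀ X = coeff-digit X 0ℤ

  coeff[-p]≡0 : ∀ {r} → r < p → coeff r (+ 0 ℤ.- P) ≡ 0
  coeff[-p]≡0 {r} r<p = coeff-outside r (+ 0 ℤ.- P) (subst (r <_) (sym ∣-P∣≡p) r<p)
    where
      ∣-P∣≡p : ℤ.∣ + 0 ℤ.- P ∣ ≡ p
      ∣-P∣≡p = trans (cong ℤ.∣_∣ (ℤₚ.+-identityˡ (ℤ.- P))) (ℤₚ.∣-i∣≡∣i∣ P)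

  T-digit : ∀ {r} X → r < p → T (r + X * p) ≡ T r * T X mod p
  T-digit {r} X r<p = begin
    T (r + X * p)                                    ≈⟨ coeff-digit₀ X r<p z≤n ⟩
    T r * T X + coeff r (+ 0 ℤ.- P) * T₁ X           ≡⟨ cong (λ u → T r * T X + u * T₁ X) (coeff[-p]≡0 r<p) ⟩
    T r * T X + 0                                    ≡⟨ +-identityʳ _ ⟩
    T r * T X                                        ∎
    where open ≡-mod-Reasoning

  T-multiple : ∀ Y → T (Y * p) ≡ T Y mod p
  T-multiple Y = ≡-mod-trans (T-digit Y 0<p) (≡⇒≡-mod (+-identityʳ (T Y)))

  T₁-multiple : ∀ Y → T₁ (Y * p) ≡ 0 mod p
  T₁-multiple Y = ≡-mod-trans (coeff-digit₀ Y 0<p (<⇒≤ 1<p)) (≡⇒≡-mod (cong (λ u → u * T₁ Y) coeff₀[1-P]≡0))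
    where
      coeff₀[1-P]≡0 : coeff 0 (+ 1 ℤ.- P) ≡ 0
      coeff₀[1-P]≡0 = coeff0-≢ (λ 1-P≡0 → <⇒≢ 1<p (ℤₚ.+-injective (ℤₚ.i-j≡0⇒i≡j (+ 1) P 1-P≡0)))

  infix 4 _∼_
  record _∼_ (X Y : ℕ) : Set where
    constructor _,_
    field
      T-≡  : T X ≡ T Y mod p
      T₁-≡ : T₁ X ≡ T₁ Y mod p

  record Vanishing (X : ℕ) : Set where
    constructor _,_
    field
      T-≡0  : T X ≡ 0 mod p
      T₁-≡0 : T₁ X ≡ 0 mod p

  private
    linear-cong : ∀ α β {u u′ v v′} → u ≡ u′ mod p → v ≡ v′ mod p → α * u + β * v ≡ α * u′ + β * v′ mod p
    linear-cong α β u≡u′ v≡v′ = +-cong-mod (*-cong-mod (≡-mod-refl {α}) u≡u′) (*-cong-mod (≡-mod-refl {β}) v≡v′)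

    linear-zero : ∀ α β {u v} → u ≡ 0 mod p → v ≡ 0 mod p → α * u + β * v ≡ 0 mod p
    linear-zero α β u≡0 v≡0 = ≡-mod-trans (linear-cong α β u≡0 v≡0) (≡⇒≡-mod (sym (x*0+y*0 α β)))

  coeff-digit-∼ : ∀ {r a X Y} → r < p → a ≤ p → X ∼ Y → coeff (r + X * p) (+ a) ≡ coeff (r + Y * p) (+ a) mod p
  coeff-digit-∼ {r} {a} {X} {Y} r<p a≤p (TX≡TY , T₁X≡T₁Y) = begin
    coeff (r + X * p) (+ a)                              ≈⟨ coeff-digit₀ X r<p a≤p ⟩
    coeff r (+ a) * T X + coeff r (+ a ℤ.- P) * T₁ X     ≈⟨ linear-cong (coeff r (+ a)) (coeff r (+ a ℤ.- P)) TX≡TY T₁X≡T₁Y ⟩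
    coeff r (+ a) * T Y + coeff r (+ a ℤ.- P) * T₁ Y     ≈⟨ coeff-digit₀ Y r<p a≤p ⟨
    coeff (r + Y * p) (+ a)                              ∎
    where open ≡-mod-Reasoning

  coeff-digit-vanishing : ∀ {r a X} → r < p → a ≤ p → Vanishing X → coeff (r + X * p) (+ a) ≡ 0 mod p
  coeff-digit-vanishing {r} {a} {X} r<p a≤p (TX≡0 , T₁X≡0) =
    ≡-mod-trans (coeff-digit₀ X r<p a≤p) (linear-zero (coeff r (+ a)) (coeff r (+ a ℤ.- P)) TX≡0 T₁X≡0)

  ∼-digit : ∀ {r X Y} → r < p → X ∼ Y → r + X * p ∼ r + Y * p
  ∼-digit r<p X∼Y = coeff-digit-∼ r<p z≤n X∼Y , coeff-digit-∼ r<p (<⇒≤ 1<p) X∼Y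

  vanishing-digit : ∀ {r X} → r < p → Vanishing X → Vanishing (r + X * p)
  vanishing-digit r<p VX = coeff-digit-vanishing r<p z≤n VX , coeff-digit-vanishing r<p (<⇒≤ 1<p) VX

  -- Motzkin n = T n - coeff n 2, and both terms are read off the state.
  Motzkin-digit : ∀ {r X Y} → r < p → X ∼ Y → Motzkin (r + X * p) ≡ Motzkin (r + Y * p) mod p
  Motzkin-digit {r} {X} {Y} r<p X∼Y = +-cancelˡ-mod (coeff m (+ 2)) (begin
    coeff m (+ 2) + Motzkin m   ≡⟨ trans (+-comm _ (Motzkin m)) (Motzkin+coeff₂≡T m) ⟩
    T m                         ≈⟨ _∼_.T-≡ (∼-digit r<p X∼Y) ⟩
    T n                         ≡⟨ trans (+-comm _ (Motzkin n)) (Motzkin+coeff₂≡T n) ⟨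
    coeff n (+ 2) + Motzkin n   ≈⟨ +-cong-mod (coeff-digit-∼ r<p 1<p X∼Y) (≡-mod-refl {Motzkin n}) ⟨
    coeff m (+ 2) + Motzkin n   ∎)
    where
      open ≡-mod-Reasoning
      m = r + X * p
      n = r + Y * p

  Motzkin-digit-vanishing : ∀ {r X} → r < p → Vanishing X → Motzkin (r + X * p) ≡ 0 mod p
  Motzkin-digit-vanishing {r} {X} r<p VX = +-cancelˡ-mod (coeff m (+ 2)) (begin
    coeff m (+ 2) + Motzkin m   ≡⟨ trans (+-comm _ (Motzkin m)) (Motzkin+coeff₂≡T m) ⟩
    T m                         ≈⟨ Vanishing.T-≡0 (vanishing-digit r<p VX) ⟩
    0                           ≈⟨ coeff-digit-vanishing r<p 1<p VX ⟨
    coeff m (+ 2)               ≡⟨ +-identityʳ _ ⟨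
    coeff m (+ 2) + 0           ∎)
    where
      open ≡-mod-Reasoning
      m = r + X * p

  T-prefix : ∀ {s} h X → s < p ^ h → T (s + X * p ^ h) ≡ T s * T X mod p
  T-prefix {zero}  zero    X _ = ≡⇒≡-mod (trans (cong T (*-identityʳ X)) (sym (+-identityʳ (T X))))
  T-prefix {suc s} zero    X (s≤s ())
  T-prefix {s}     (suc h) X s<p^[1+h] = begin
    T (s + X * p ^ suc h)                        ≡⟨ cong T (split-lowest-digit p s X h) ⟩
    T (s % p + (s / p + X * p ^ h) * p)          ≈⟨ T-digit (s / p + X * p ^ h) (m%n<n s p) ⟩
    T (s % p) * T (s / p + X * p ^ h)            ≈⟨ *-cong-mod (≡-mod-refl {T (s % p)}) (T-prefix h X (quotient-< p h s<p^[1+h])) ⟩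
    T (s % p) * (T (s / p) * T X)                ≡⟨ *-assoc (T (s % p)) _ _ ⟨
    T (s % p) * T (s / p) * T X                  ≈⟨ *-cong-mod (T-digit (s / p) (m%n<n s p)) (≡-mod-refl {T X}) ⟨
    T (s % p + s / p * p) * T X                  ≡⟨ cong (λ m → T m * T X) (m≡m%n+[m/n]*n s p) ⟨
    T s * T X                                    ∎
    where open ≡-mod-Reasoning

  ∼-prefix : ∀ {n X Y} L → X ∼ Y → n < p ^ L → n + X * p ^ L ∼ n + Y * p ^ L
  ∼-prefix {zero}  {X} {Y} zero X∼Y _ = subst₂ _∼_ (sym (*-identityʳ X)) (sym (*-identityʳ Y)) X∼Y
  ∼-prefix {suc n} zero X∼Y (s≤s ())
  ∼-prefix {n} {X} {Y} (suc L) X∼Y n<p^[1+L] =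
    subst₂ _∼_ (sym (split-lowest-digit p n X L)) (sym (split-lowest-digit p n Y L))
      (∼-digit (m%n<n n p) (∼-prefix L X∼Y (quotient-< p L n<p^[1+L])))

  Motzkin-prefix : ∀ {n X Y} L → X ∼ Y → n < p ^ suc L →
                   Motzkin (n + X * p ^ suc L) ≡ Motzkin (n + Y * p ^ suc L) mod p
  Motzkin-prefix {n} {X} {Y} L X∼Y n<p^[1+L] = begin
    Motzkin (n + X * p ^ suc L)                   ≡⟨ cong Motzkin (split-lowest-digit p n X L) ⟩
    Motzkin (n % p + (n / p + X * p ^ L) * p)     ≈⟨ Motzkin-digit (m%n<n n p) (∼-prefix L X∼Y (quotient-< p L n<p^[1+L])) ⟩
    Motzkin (n % p + (n / p + Y * p ^ L) * p)     ≡⟨ cong Motzkin (split-lowest-digit p n Y L) ⟨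
    Motzkin (n + Y * p ^ suc L)                   ∎
    where open ≡-mod-Reasoning

  T-lowest-digit : ∀ n → T n ≡ T (n % p) * T (n / p) mod p
  T-lowest-digit n = ≡-mod-trans (≡⇒≡-mod (cong T (m≡m%n+[m/n]*n n p))) (T-digit (n / p) (m%n<n n p))

  p∣T⇒p∣T-digit : ∀ n → p ∣ T n → ∃[ d ] (d < p × p ∣ T d)
  p∣T⇒p∣T-digit = <-rec _ step
    where
      step : ∀ n → (∀ {m} → m < n → p ∣ T m → ∃[ d ] (d < p × p ∣ T d)) → p ∣ T n → ∃[ d ] (d < p × p ∣ T d)
      step n IH p∣Tn with n <? p
      ... | yes n<p = n , n<p , p∣Tn
      ... | no  n≮p with euclidsLemma (T (n % p)) (T (n / p)) pp
                           (≡0-mod⇒∣ (≡-mod-trans (sym (T-lowest-digit n)) (∣⇒≡0-mod p∣Tn)))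
      ...   | inj₁ p∣T[n%p] = n % p , m%n<n n p , p∣T[n%p]
      ...   | inj₂ p∣T[n/p] = IH (m/n<m n p {{n-nonZero}} 1<p) p∣T[n/p]
        where
          n-nonZero : NonZero n
          n-nonZero = >-nonZero (<-≤-trans 0<p (≮⇒≥ n≮p))

  vanishing-multiple : ∀ Z → T Z ≡ 0 mod p → Vanishing (Z * p)
  vanishing-multiple Z TZ≡0 = ≡-mod-trans (T-multiple Z) TZ≡0 , T₁-multiple Z

-- Density of the zeros when p divides some T n

module MotzkinDensity {p} (pp : Prime p) {d} (d<p : d < p) (p∣Td : p ∣ T d) where

  open LucasCongruence pp

  q : ℕ
  q = p * p

  instance
    q-nonZero : NonZero q
    q-nonZero = m*n≢0 p p

  zeros? : Decidable (λ n → (Motzkin n mod′ p) {pp} ≡ 0)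
  zeros? n = (Motzkin n mod′ p) {pp} ≟ 0

  Motzkin≡0⇒mod′≡0 : ∀ n → Motzkin n ≡ 0 mod p → (Motzkin n mod′ p) {pp} ≡ 0
  Motzkin≡0⇒mod′≡0 n Mₙ≡0 = trans Mₙ≡0 0%m≡0

  -- avoids m X is 0 iff one of the lowest m base-q digits of X is d p.
  avoids : ℕ → ℕ → ℕ
  avoids zero    X = 1
  avoids (suc m) X = fails (X % q ≟ d * p) * avoids m (X / q)

  vanishing-at-pair : ∀ {X} → X % q ≡ d * p → Vanishing X
  vanishing-at-pair {X} X%q≡dp = subst Vanishing (sym X≡[d+Yp]p) (vanishing-multiple (d + Y * p) (begin
    T (d + Y * p)     ≈⟨ T-digit Y d<p ⟩
    T d * T Y         ≈⟨ *-cong-mod (∣⇒≡0-mod p∣Td) (≡-mod-refl {T Y}) ⟩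
    0                 ∎))
    where
      open ≡-mod-Reasoning
      Y = X / q
      X≡[d+Yp]p : X ≡ (d + Y * p) * p
      X≡[d+Yp]p = trans (m≡m%n+[m/n]*n X q) (trans (cong (_+ Y * q) X%q≡dp) (regroup d Y p))
        where
          regroup : ∀ d Y p → d * p + Y * (p * p) ≡ (d + Y * p) * p
          regroup = solve-∀

  vanishing-by-quotient : ∀ {X} → Vanishing (X / q) → Vanishing X
  vanishing-by-quotient {X} V[X/q] = subst Vanishing (sym X≡digits)
    (vanishing-digit (m%n<n X p) (vanishing-digit (m%n<n (X / p) p) (subst Vanishing X/q≡X/p/p V[X/q])))
    where
      X/q≡X/p/p : X / q ≡ X / p / p
      X/q≡X/p/p = sym (m/n/o≡m/[n*o] X p p)
      X≡digits : X ≡ X % p + (X / p % p + X / p / p * p) * p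
      X≡digits = trans (m≡m%n+[m/n]*n X p) (cong (λ Y → X % p + Y * p) (m≡m%n+[m/n]*n (X / p) p))

  avoids≡0⇒vanishing : ∀ m X → avoids m X ≡ 0 → Vanishing X
  avoids≡0⇒vanishing (suc m) X avoids≡0 with m*n≡0⇒m≡0∨n≡0 (fails (X % q ≟ d * p)) avoids≡0
  ... | inj₁ pair  = vanishing-at-pair (fails≡0⇒ (X % q ≟ d * p) pair)
  ... | inj₂ above = vanishing-by-quotient (avoids≡0⇒vanishing m (X / q) above)

  ∑avoids : ∀ m → ∑[ X < q ^ m ] avoids m X ≡ (q ∸ 1) ^ m
  ∑avoids zero    = refl
  ∑avoids (suc m) = begin
    ∑[ X < q * q ^ m ] avoids (suc m) X                   ≡⟨ cong (λ N → ∑< N (avoids (suc m))) (*-comm q (q ^ m)) ⟩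
    ∑[ X < q ^ m * q ] avoids (suc m) X                   ≡⟨ ∑-%-/ (q ^ m) q (λ r → fails (r ≟ d * p)) (avoids m) ⟩
    ∑[ r < q ] fails (r ≟ d * p) * ∑[ Y < q ^ m ] avoids m Y ≡⟨ cong₂ _*_ ∑fails≡q-1 (∑avoids m) ⟩
    (q ∸ 1) * (q ∸ 1) ^ m                                 ∎
    where
      open ≡-Reasoning
      ∑fails≡q-1 : ∑[ r < q ] fails (r ≟ d * p) ≡ q ∸ 1
      ∑fails≡q-1 = trans (sym (m+n∸n≡m _ 1)) (cong (_∸ 1) (∑fails-≟ (*-monoˡ-< p d<p)))

  fails≤avoids : ∀ m n → fails (zeros? n) ≤ 1 * avoids m (n / p)
  fails≤avoids m n with avoids m (n / p) ≟ 0
  ... | yes avoids≡0 = subst (_≤ 1 * avoids m (n / p)) (sym (fails-yes (zeros? n) (Motzkin≡0⇒mod′≡0 n Mn≡0))) z≤n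
    where
      Mn≡0 : Motzkin n ≡ 0 mod p
      Mn≡0 = ≡-mod-trans (≡⇒≡-mod (cong Motzkin (m≡m%n+[m/n]*n n p)))
                         (Motzkin-digit-vanishing (m%n<n n p) (avoids≡0⇒vanishing m (n / p) avoids≡0))
  ... | no  avoids≢0 = ≤-trans (fails≤1 (zeros? n)) (subst (1 ≤_) (sym (*-identityˡ _)) (n≢0⇒n>0 avoids≢0))

  failures-bound : ∀ m → ∑[ n < q ^ m * p ] fails (zeros? n) ≤ p * (q ∸ 1) ^ m
  failures-bound m = begin
    ∑[ n < q ^ m * p ] fails (zeros? n)              ≤⟨ ∑-mono-≤ (q ^ m * p) (fails≤avoids m) ⟩
    ∑[ n < q ^ m * p ] (1 * avoids m (n / p))        ≡⟨ ∑-%-/ (q ^ m) p (λ _ → 1) (avoids m) ⟩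
    ∑[ r < p ] 1 * ∑[ Y < q ^ m ] avoids m Y         ≡⟨ cong₂ _*_ (trans (∑-const p 1) (*-identityʳ p)) (∑avoids m) ⟩
    p * (q ∸ 1) ^ m                                  ∎
    where open ≤-Reasoning

  densityOne : HasDensityOne zeros?
  densityOne = density-from-bound zeros? (<-≤-trans 1<p (m≤m*n p p)) failures-bound

-- Uniform recurrence when p divides no T n

module MotzkinRecurrence {p} (pp : Prime p) (p∤T : ∀ n → ¬ p ∣ T n) where

  open LucasCongruence pp

  ∏T : ℕ → (ℕ → ℕ) → ℕ
  ∏T zero    e = 1
  ∏T (suc n) e = ∏T n e * T n ^ e n

  ∏T-cong : ∀ n {e e′} → (∀ r → r < n → e r ≡ e′ r) → ∏T n e ≡ ∏T n e′
  ∏T-cong zero    _    = refl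
  ∏T-cong (suc n) e≡e′ = cong₂ (λ u v → u * T n ^ v) (∏T-cong n (λ r r<n → e≡e′ r (m<n⇒m<1+n r<n))) (e≡e′ n (n<1+n n))

  ∏T-zero : ∀ n → ∏T n (λ _ → 0) ≡ 1
  ∏T-zero zero    = refl
  ∏T-zero (suc n) = trans (*-identityʳ _) (∏T-zero n)

  bump : ℕ → ℕ → (ℕ → ℕ) → (ℕ → ℕ)
  bump r k e r′ with r′ ≟ r
  ... | yes _ = e r′ + k
  ... | no  _ = e r′

  bump-≢ : ∀ {r r′} k e → r′ ≢ r → bump r k e r′ ≡ e r′
  bump-≢ {r} {r′} k e r′≢r with r′ ≟ r
  ... | yes r′≡r = contradiction r′≡r r′≢r
  ... | no  _    = refl

  ∏T-bump : ∀ {r n} k e → r < n → ∏T n (bump r k e) ≡ ∏T n e * T r ^ k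
  ∏T-bump {r} {suc n} k e r<1+n with m<1+n⇒m<n∨m≡n r<1+n
  ... | inj₁ r<n = begin
    ∏T n (bump r k e) * T n ^ bump r k e n  ≡⟨ cong₂ (λ u v → u * T n ^ v) (∏T-bump k e r<n) (bump-≢ k e (>⇒≢ r<n)) ⟩
    ∏T n e * T r ^ k * T n ^ e n            ≡⟨ x*y*z≡x*z*y (∏T n e) (T r ^ k) (T n ^ e n) ⟩
    ∏T n e * T n ^ e n * T r ^ k            ∎
    where
      open ≡-Reasoning
      x*y*z≡x*z*y : ∀ x y z → x * y * z ≡ x * z * y
      x*y*z≡x*z*y = solve-∀
  ... | inj₂ refl = begin
    ∏T n (bump n k e) * T n ^ bump n k e n  ≡⟨ cong₂ (λ u v → u * T n ^ v) (∏T-cong n (λ r′ r′<n → bump-≢ k e (<⇒≢ r′<n))) bump-at ⟩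
    ∏T n e * T n ^ (e n + k)                ≡⟨ cong (∏T n e *_) (^-distribˡ-+-* (T n) (e n) k) ⟩
    ∏T n e * (T n ^ e n * T n ^ k)          ≡⟨ *-assoc (∏T n e) _ _ ⟨
    ∏T n e * T n ^ e n * T n ^ k            ∎
    where
      open ≡-Reasoning
      bump-at : bump n k e n ≡ e n + k
      bump-at with n ≟ n
      ... | yes _   = refl
      ... | no  n≢n = contradiction refl n≢n

  instance
    p∸1-nonZero : NonZero (p ∸ 1)
    p∸1-nonZero = >-nonZero (∸-monoˡ-< {n = 1} 1<p (s≤s z≤n))

  T^[p∸1]≡1 : ∀ r → T r ^ (p ∸ 1) ≡ 1 mod p
  T^[p∸1]≡1 r = fermat′ (p∤T r)

  T^-reduce : ∀ r k → T r ^ k ≡ T r ^ (k % (p ∸ 1)) mod p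
  T^-reduce r k = begin
    T r ^ k                                          ≡⟨ cong (T r ^_) (m≡m%n+[m/n]*n k (p ∸ 1)) ⟩
    T r ^ (k % (p ∸ 1) + k / (p ∸ 1) * (p ∸ 1))      ≡⟨ ^-distribˡ-+-* (T r) (k % (p ∸ 1)) _ ⟩
    T r ^ (k % (p ∸ 1)) * T r ^ (k / (p ∸ 1) * (p ∸ 1)) ≡⟨ cong (λ j → T r ^ (k % (p ∸ 1)) * T r ^ j) (*-comm (k / (p ∸ 1)) (p ∸ 1)) ⟩
    T r ^ (k % (p ∸ 1)) * T r ^ ((p ∸ 1) * (k / (p ∸ 1))) ≡⟨ cong (T r ^ (k % (p ∸ 1)) *_) (^-*-assoc (T r) (p ∸ 1) (k / (p ∸ 1))) ⟨
    T r ^ (k % (p ∸ 1)) * (T r ^ (p ∸ 1)) ^ (k / (p ∸ 1)) ≈⟨ *-cong-mod (≡-mod-refl {T r ^ (k % (p ∸ 1))}) (^-cong-mod (k / (p ∸ 1)) (T^[p∸1]≡1 r)) ⟩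
    T r ^ (k % (p ∸ 1)) * 1 ^ (k / (p ∸ 1))          ≡⟨ cong (T r ^ (k % (p ∸ 1)) *_) (^-zeroˡ (k / (p ∸ 1))) ⟩
    T r ^ (k % (p ∸ 1)) * 1                          ≡⟨ *-identityʳ _ ⟩
    T r ^ (k % (p ∸ 1))                              ∎
    where open ≡-mod-Reasoning

  ∏T-reduce : ∀ n e → ∏T n e ≡ ∏T n (λ r → e r % (p ∸ 1)) mod p
  ∏T-reduce zero    e = ≡-mod-refl
  ∏T-reduce (suc n) e = *-cong-mod (∏T-reduce n e) (T^-reduce n (e n))

  -- Every digit r of X contributes a factor T r to T X, which T r ^ (p ∸ 2) inverts.
  inverse-exponents : ∀ X → ∃[ e ] (∏T p e * T X ≡ 1 mod p)
  inverse-exponents = <-rec _ step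
    where
      step : ∀ X → (∀ {Y} → Y < X → ∃[ e ] (∏T p e * T Y ≡ 1 mod p)) → ∃[ e ] (∏T p e * T X ≡ 1 mod p)
      step zero    _  = (λ _ → 0) , ≡⇒≡-mod (cong (_* 1) (∏T-zero p))
      step X@(suc _) IH with IH (m/n<m X p 1<p)
      ... | e , ∏Te*TY≡1 = bump r (p ∸ 2) e , (begin
        ∏T p (bump r (p ∸ 2) e) * T X                    ≡⟨ cong (_* T X) (∏T-bump (p ∸ 2) e r<p) ⟩
        ∏T p e * T r ^ (p ∸ 2) * T X                     ≈⟨ *-cong-mod (≡-mod-refl {∏T p e * T r ^ (p ∸ 2)}) (T-lowest-digit X) ⟩
        ∏T p e * T r ^ (p ∸ 2) * (T r * T Y)             ≡⟨ regroup (∏T p e) (T r ^ (p ∸ 2)) (T r) (T Y) ⟩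
        ∏T p e * T Y * (T r * T r ^ (p ∸ 2))             ≡⟨ cong (λ j → ∏T p e * T Y * T r ^ j) (+-∸-assoc 1 1<p) ⟨
        ∏T p e * T Y * T r ^ (p ∸ 1)                     ≈⟨ *-cong-mod ∏Te*TY≡1 (T^[p∸1]≡1 r) ⟩
        1                                                ∎)
        where
          open ≡-mod-Reasoning
          r = X % p
          Y = X / p
          r<p : r < p
          r<p = m%n<n X p
          regroup : ∀ a b c y → a * b * (c * y) ≡ a * y * (c * b)
          regroup = solve-∀

  repeat : ℕ → ℕ → ℕ
  repeat r zero    = 0
  repeat r (suc k) = r + repeat r k * p

  T-repeat : ∀ {r} k → r < p → T (repeat r k) ≡ T r ^ k mod p
  T-repeat zero    r<p = ≡-mod-refl
  T-repeat {r} (suc k) r<p = ≡-mod-trans (T-digit (repeat r k) r<p) (*-cong-mod (≡-mod-refl {T r}) (T-repeat k r<p))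

  repeat-< : ∀ {r} k → r < p → repeat r k < p ^ k
  repeat-< zero    r<p = z<s
  repeat-< {r} (suc k) r<p = begin-strict
    r + repeat r k * p    <⟨ +-monoˡ-< (repeat r k * p) r<p ⟩
    suc (repeat r k) * p  ≤⟨ *-monoˡ-≤ p (repeat-< k r<p) ⟩
    p ^ k * p             ≡⟨ *-comm (p ^ k) p ⟩
    p ^ suc k             ∎
    where open ≤-Reasoning

  -- The number whose base-p digits are e r copies of r for each r < n.
  withDigits : ℕ → (ℕ → ℕ) → ℕ
  withDigits zero    e = 0
  withDigits (suc n) e = repeat n (e n) + withDigits n e * p ^ e n

  T-withDigits : ∀ n e → n ≤ p → T (withDigits n e) ≡ ∏T n e mod p
  T-withDigits zero    e _   = ≡-mod-refl
  T-withDigits (suc n) e n<p = begin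
    T (repeat n (e n) + withDigits n e * p ^ e n)   ≈⟨ T-prefix (e n) (withDigits n e) (repeat-< (e n) n<p) ⟩
    T (repeat n (e n)) * T (withDigits n e)         ≈⟨ *-cong-mod (T-repeat (e n) n<p) (T-withDigits n e (<⇒≤ n<p)) ⟩
    T n ^ e n * ∏T n e                              ≡⟨ *-comm (T n ^ e n) (∏T n e) ⟩
    ∏T n e * T n ^ e n                              ∎
    where open ≡-mod-Reasoning

  withDigits-< : ∀ n e → n ≤ p → (∀ r → e r ≤ p) → withDigits n e < p ^ (n * p)
  withDigits-< zero    e _   _     = z<s
  withDigits-< (suc n) e n<p e≤p = <-≤-trans (digits-< p (e n) (n * p) (repeat-< (e n) n<p) (withDigits-< n e (<⇒≤ n<p) e≤p))
                                             (^-monoʳ-≤ p (+-monoˡ-≤ (n * p) (e≤p n)))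

  H : ℕ
  H = p * p

  -- Exponents matter only modulo p ∸ 1, so fewer than p digits of each value suffice.
  bounded-inverse : ∀ X → ∃[ s ] (s < p ^ H × T s * T X ≡ 1 mod p)
  bounded-inverse X with inverse-exponents X
  ... | e , ∏Te*TX≡1 = withDigits p e′ , withDigits-< p e′ ≤-refl e′≤p , (begin
    T (withDigits p e′) * T X    ≈⟨ *-cong-mod (T-withDigits p e′ ≤-refl) (≡-mod-refl {T X}) ⟩
    ∏T p e′ * T X                ≈⟨ *-cong-mod (∏T-reduce p e) (≡-mod-refl {T X}) ⟨
    ∏T p e * T X                 ≈⟨ ∏Te*TX≡1 ⟩
    1                            ∎)
    where
      open ≡-mod-Reasoning
      e′ : ℕ → ℕ
      e′ r = e r % (p ∸ 1)
      e′≤p : ∀ r → e′ r ≤ p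
      e′≤p r = ≤-trans (m%n≤n (e r) (p ∸ 1)) (m∸n≤m p 1)

  B : ℕ
  B = p ^ H * p

  instance
    B-nonZero : NonZero B
    B-nonZero = m*n≢0 (p ^ H) p {{>-nonZero (m^n>0 p H)}}

  syndetic : ∀ x → ∃[ y ] (x < y × y ≤ x + 2 * B × y ∼ 0)
  syndetic x = spread (bounded-inverse Z)
    where
      Z = suc (x / B)
      spread : ∃[ s ] (s < p ^ H × T s * T Z ≡ 1 mod p) → ∃[ y ] (x < y × y ≤ x + 2 * B × y ∼ 0)
      spread (s , s<p^H , Ts*TZ≡1) =
        Y * p , subst (x <_) (sym Yp≡sp+ZB) above , subst (_≤ x + 2 * B) (sym Yp≡sp+ZB) below , (TYp≡1 , T₁-multiple Y)
        where
          Y = s + Z * p ^ H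
          TYp≡1 : T (Y * p) ≡ 1 mod p
          TYp≡1 = ≡-mod-trans (T-multiple Y) (≡-mod-trans (T-prefix H Z s<p^H) Ts*TZ≡1)
          Yp≡sp+ZB : Y * p ≡ s * p + Z * B
          Yp≡sp+ZB = regroup s Z (p ^ H) p
            where
              regroup : ∀ s Z h p → (s + Z * h) * p ≡ s * p + Z * (h * p)
              regroup = solve-∀
          above-below = next-multiple B x (*-monoˡ-≤ p (<⇒≤ s<p^H))
          above = proj₁ above-below
          below = proj₂ above-below

  occurs-above : ∀ {y} i ℓ → y ∼ 0 → OccursAt (λ n → (Motzkin n mod′ p) {pp}) i ℓ (i + y * p ^ suc (i + ℓ))
  occurs-above {y} i ℓ y∼0 t t<ℓ = begin
    Motzkin (i + y * W + t)    ≡⟨ cong Motzkin (x+y+z≡x+z+y i (y * W) t) ⟩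
    Motzkin (i + t + y * W)    ≈⟨ Motzkin-prefix (i + ℓ) y∼0 i+t<W ⟩
    Motzkin (i + t + 0)        ≡⟨ cong Motzkin (+-identityʳ (i + t)) ⟩
    Motzkin (i + t)            ∎
    where
      open ≡-mod-Reasoning
      W = p ^ suc (i + ℓ)
      x+y+z≡x+z+y : ∀ x y z → x + y + z ≡ x + z + y
      x+y+z≡x+z+y = solve-∀
      i+t<W : i + t < W
      i+t<W = <-trans (+-monoʳ-< i t<ℓ) (<-trans (n<1+n (i + ℓ)) (n<b^n 1<p (suc (i + ℓ))))

  uniformlyRecurrent : UniformlyRecurrent (λ n → (Motzkin n mod′ p) {pp})
  uniformlyRecurrent i ℓ = i + 2 * B * W , λ j _ → next j (syndetic (j / W))
    where
      W = p ^ suc (i + ℓ)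
      instance
        W-nonZero : NonZero W
        W-nonZero = >-nonZero (m^n>0 p (suc (i + ℓ)))
      next : ∀ j → ∃[ y ] (j / W < y × y ≤ j / W + 2 * B × y ∼ 0) →
             ∃[ k ] (j < k × k ≤ j + (i + 2 * B * W) × OccursAt (λ n → (Motzkin n mod′ p) {pp}) i ℓ k)
      next j (y , j/W<y , y≤j/W+2B , y∼0) =
        i + y * W , proj₁ window , proj₂ window , occurs-above i ℓ y∼0
        where window = scaled-window W i j/W<y y≤j/W+2B

corollary3p10 : (p : ℕ) (pp : Prime p) →
    (UniformlyRecurrent (λ n → (Motzkin n mod′ p) {pp}) ⇔ (∀ n → ¬ (p ∣ T n)))
    × ((∃[ n ] (p ∣ T n)) →
       HasDensityOne (λ n → (Motzkin n mod′ p) {pp} ≟ 0))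
corollary3p10 p pp = mk⇔ recurrent⇒p∤T (MotzkinRecurrence.uniformlyRecurrent pp) , densityOne
  where
    open LucasCongruence pp using (p∣T⇒p∣T-digit; 1<p; p-nonZero)
    densityOne : ∃[ n ] (p ∣ T n) → HasDensityOne (λ n → (Motzkin n mod′ p) {pp} ≟ 0)
    densityOne (n , p∣Tn) = let d , d<p , p∣Td = p∣T⇒p∣T-digit n p∣Tn in MotzkinDensity.densityOne pp d<p p∣Td
    M₀≢0 : (Motzkin 0 mod′ p) {pp} ≢ 0
    M₀≢0 = subst (_≢ 0) (sym (m<n⇒m%n≡m 1<p)) (λ ())
    recurrent⇒p∤T : UniformlyRecurrent (λ n → (Motzkin n mod′ p) {pp}) → ∀ n → ¬ p ∣ T n
    recurrent⇒p∤T recurrent n p∣Tn = uniformlyRecurrent⇒¬densityOne recurrent 0 M₀≢0 (densityOne (n , p∣Tn))
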